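{- Let $a$ and $b$ be positive integers such that $a\not\equiv 0 \pmod 4$, $b$ is squarefree, and $\mathcal{D}$ is squarefree, where $\mathcal{D}=a^2+4b$ if $a$ is odd and $\mathcal{D}=(a/2)^2+b$ if $a$ is even. Let $f(x)=x^2-ax-b$ and $\alpha=(a+\sqrt{a^2+4b})/2$. Let $p\ge 3$ be a prime such that $\left(\frac{\mathcal{D}}{p}\right)=-1$. Then the following are equivalent: (1) $p$ is an $(a,b)$-Wall-Sun-Sun prime; (2) $f(\alpha^{p^m})\equiv 0\pmod{p^2}$ for all integers $m\ge 1$; (3) $f(\alpha^{p^m})\equiv 0\pmod{p^2}$ for some integer $m\ge 1$.
   Context: Let $[U_n]$ be the Lucas sequence defined by $U_0=0$, $U_1=1$, $U_n=aU_{n-1}+bU_{n-2}$ for $n\ge 2$, and for $m\ge 2$ with $\gcd(b,m)=1$ let $\pi(m)$ be the length of the period of $[U_n]$ modulo $m$. An $(a,b)$-Wall-Sun-Sun prime is a prime $p$ with $\gcd(b,p)=1$ such that $\pi(p^2)=\pi(p)$. Congruences involving $\alpha$ are in the ring $\mathbb{Z}[\alpha]$, i.e. modulo $p^2\mathbb{Z}[\alpha]$. $\left(\frac{\cdot}{p}\right)$ is the Legendre symbol. -}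

module Defs where

open import Data.Nat as ℕ using (ℕ; zero; suc; _<_; _≤_; _≡ᵇ_)
open import Data.Nat.Divisibility as ℕD using ()
open import Data.Nat.Coprimality using (Coprime)
open import Data.Nat.DivMod using (_/_; _%_)
open import Data.Integer as ℤ using (ℤ; +_)
open import Data.Integer.Divisibility as ℤD using ()
open import Data.Product using (_×_; _,_; ∃-syntax; proj₁; proj₂)
open import Relation.Binary.PropositionalEquality using (_≡_)
open import Relation.Nullary using (¬_)

Squarefree : ℕ → Set
Squarefree n = ∀ d → (d ℕ.* d) ℕD.∣ n → d ≡ 1

𝒟 : ℕ → ℕ → ℕ
𝒟 a b with a % 2
... | zero  = (a / 2) ℕ.* (a / 2) ℕ.+ b
... | suc _ = a ℕ.* a ℕ.+ 4 ℕ.* b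

_≡_[mod_] : ℤ → ℤ → ℕ → Set
x ≡ y [mod m ] = (+ m) ℤD.∣ (x ℤ.- y)

LegendreMinusOne : ℕ → ℕ → Set
LegendreMinusOne D p = ¬ (p ℕD.∣ D) × (∀ (x : ℤ) → ¬ ((x ℤ.* x) ≡ (+ D) [mod p ]))

U : ℤ → ℤ → ℕ → ℤ
U a b zero = + 0
U a b (suc zero) = + 1
U a b (suc (suc n)) = a ℤ.* U a b (suc n) ℤ.+ b ℤ.* U a b n

IsPeriod : ℤ → ℤ → ℕ → ℕ → Set
IsPeriod a b m n = 0 < n × (∀ k → U a b (k ℕ.+ n) ≡ U a b k [mod m ])

IsPeriodLength : ℤ → ℤ → ℕ → ℕ → Set
IsPeriodLength a b m n = IsPeriod a b m n × (∀ n′ → IsPeriod a b m n′ → n ≤ n′)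

WallSunSun : ℕ → ℕ → ℕ → Set
WallSunSun a b p =
  Coprime b p × ∃[ n ] (IsPeriodLength (+ a) (+ b) (p ℕ.* p) n × IsPeriodLength (+ a) (+ b) p n)

-- The ring ℤ[α], α² = aα + b (α = (a + √(a²+4b))/2), elements u + vα as pairs (u , v),
-- {1, α} being a ℤ-basis.
Zα : Set
Zα = ℤ × ℤ

module ZAlpha (a b : ℤ) where
  _⊕_ : Zα → Zα → Zα
  (u₁ , v₁) ⊕ (u₂ , v₂) = (u₁ ℤ.+ u₂ , v₁ ℤ.+ v₂)

  _⊖_ : Zα → Zα → Zα
  (u₁ , v₁) ⊖ (u₂ , v₂) = (u₁ ℤ.- u₂ , v₁ ℤ.- v₂)

  -- (u₁ + v₁α)(u₂ + v₂α) = (u₁u₂ + b v₁v₂) + (u₁v₂ + v₁u₂ + a v₁v₂)α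
  _⊗_ : Zα → Zα → Zα
  (u₁ , v₁) ⊗ (u₂ , v₂) =
    (u₁ ℤ.* u₂ ℤ.+ b ℤ.* (v₁ ℤ.* v₂) , u₁ ℤ.* v₂ ℤ.+ v₁ ℤ.* u₂ ℤ.+ a ℤ.* (v₁ ℤ.* v₂))

  one : Zα
  one = (+ 1 , + 0)

  α : Zα
  α = (+ 0 , + 1)

  _^α_ : Zα → ℕ → Zα
  x ^α zero = one
  x ^α suc n = x ⊗ (x ^α n)

  ι : ℤ → Zα
  ι z = (z , + 0)

  f : Zα → Zα
  f x = ((x ⊗ x) ⊖ (ι a ⊗ x)) ⊖ ι b

  ≡0[mod_] : ℕ → Zα → Set
  ≡0[mod m ] (u , v) = u ≡ + 0 [mod m ] × v ≡ + 0 [mod m ]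

FαCong : ℕ → ℕ → ℕ → ℕ → Set
FαCong a b p m = ≡0[mod p ℕ.* p ] (f (α ^α (p ℕ.^ m)))
  where open ZAlpha (+ a) (+ b)

{-# OPTIONS --safe #-}
module Submission where

-- Work in ℤ[α] = ℤ ⊕ ℤα with α² = aα + b, let β = a − α be the other root of f and σ the
-- conjugation α ↦ β; put Δ = a² + 4b and δ = β − α, so that δ² = Δ.
--
-- Since Δ is 𝒟 or 4𝒟, it is a quadratic non-residue modulo the odd prime p, and Euler's
-- criterion (proved by counting roots of X^((p−1)/2) − 1) gives Δ^((p−1)/2) ≡ −1. Hence
-- δ^p ≡ −δ, and applying the Frobenius congruence (x + y)^p ≡ x^p + y^p (mod p) to a = δ + 2α
-- yields α^p ≡ β (mod p).
--
-- Raising to the p-th power turns congruences modulo p into congruences modulo p², so γ = α^p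
-- satisfies γ^p ≡ σγ (mod p²), and α^(p^m) is congruent to γ or σγ. As f commutes with σ,
-- f(α^(p^m)) ≡ 0 (mod p²) for one m ≥ 1 iff for all of them iff f(γ) ≡ 0. Writing
-- f(γ) = (γ − β)² + δ(γ − β) with γ − β ≡ 0 (mod p) and δ invertible modulo p, this is
-- equivalent to γ ≡ β, i.e. to α^(p²) ≡ α, i.e. to α^(p²−1) ≡ 1 (mod p²).
--
-- Finally α^(n+1) = bUₙ + Uₙ₊₁α, so n is a period of U modulo m iff α^n ≡ 1 (mod m). The
-- period N modulo p divides p² − 1 = qN with p ∤ q, and (1 + E)^q ≡ 1 + qE (mod p²) for
-- E ≡ 0 (mod p) shows that α^N ≡ 1 (mod p²), i.e. π(p²) = π(p), iff α^(p²−1) ≡ 1 (mod p²).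

open import Level using (0ℓ; _⊔_)
open import Algebra.Bundles using (CommutativeRing; CommutativeSemiring)
open import Algebra.Structures using (IsCommutativeRing)
open import Data.Nat as ℕ using (ℕ; zero; suc; _<_; _≤_; z≤n; s≤s; z<s; s<s; _!)
import Data.Nat.Properties as ℕ
import Data.Nat.Divisibility as ℕ
open import Data.Nat.DivMod using (_%_; _/_; m/n*n≡m; m≡m%n+[m/n]*n; m%n<n)
open import Data.Nat.Primality
  using (Prime; euclidsLemma; prime⇒nonZero; prime⇒nonTrivial; prime⇒irreducible; ¬prime[0]; ¬prime[1])
open import Data.Nat.Coprimality using (Coprime)
open import Data.Nat.Combinatorics using (_C_; nCn≡1; nCk≡n!/k![n-k]!; k![n∸k]!∣n!)
import Data.Nat.Tactic.RingSolver as ℕ-Solver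
open import Data.Fin as Fin using (toℕ; inject₁; fromℕ)
open import Data.Fin.Properties using (toℕ-inject₁; toℕ<n; toℕ-fromℕ)
open import Data.Sum using (_⊎_; inj₁; inj₂; [_,_]′)
open import Data.Product using (_,_; ∃-syntax)
open import Function using (id; _∘_)
open import Function.Bundles using (_⇔_; mk⇔; Equivalence)
open import Function.Properties.Equivalence using () renaming (trans to ⇔-trans; sym to ⇔-sym)
open import Relation.Nullary using (¬_; contradiction; Dec; yes; no)
open import Relation.Nullary.Decidable using (map′; _×-dec_)
open import Relation.Unary using (Pred; Decidable)
open import Relation.Binary.Definitions using (_Respects_)
open import Relation.Binary.PropositionalEquality as ≡ using (_≡_)
open import Defs

prime∤1 : ∀ {p} → Prime p → ¬ p ℕ.∣ 1
prime∤1 {p} p-prime = ℕ.>⇒∤ (ℕ.nonTrivial⇒n>1 p {{prime⇒nonTrivial p-prime}})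

prime∤! : ∀ {p} → Prime p → ∀ {j} → j < p → ¬ p ℕ.∣ j !
prime∤! p-prime {zero}  _   = prime∤1 p-prime
prime∤! p-prime {suc j} j<p p∣j! with euclidsLemma (suc j) (j !) p-prime p∣j!
... | inj₁ p∣1+j = ℕ.>⇒∤ j<p p∣1+j
... | inj₂ p∣j!  = prime∤! p-prime (ℕ.<-trans (ℕ.n<1+n j) j<p) p∣j!

n∣n! : ∀ {n} → 0 < n → n ℕ.∣ n !
n∣n! {suc n} _ = ℕ.∣m⇒∣m*n (n !) ℕ.∣-refl

nCk*k!*[n∸k]!≡n! : ∀ {n k} → k ≤ n → (n C k) ℕ.* (k ! ℕ.* (n ℕ.∸ k) !) ≡ n !
nCk*k!*[n∸k]!≡n! {n} {k} k≤n =
  ≡.trans (≡.cong (λ c → c ℕ.* (k ! ℕ.* (n ℕ.∸ k) !)) (nCk≡n!/k![n-k]! k≤n)) (m/n*n≡m (k![n∸k]!∣n! k≤n))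
  where instance _ = k ℕ.!* (n ℕ.∸ k) !≢0

prime∣C : ∀ {p} → Prime p → ∀ {k} → 0 < k → k < p → p ℕ.∣ p C k
prime∣C {p} p-prime {k} 0<k k<p
  with euclidsLemma (p C k) (k ! ℕ.* (p ℕ.∸ k) !) p-prime
         (≡.subst (p ℕ.∣_) (≡.sym (nCk*k!*[n∸k]!≡n! (ℕ.<⇒≤ k<p))) (n∣n! (ℕ.<-trans 0<k k<p)))
... | inj₁ p∣C = p∣C
... | inj₂ p∣k!*[p-k]! with euclidsLemma (k !) ((p ℕ.∸ k) !) p-prime p∣k!*[p-k]!
...   | inj₁ p∣k!     = contradiction p∣k! (prime∤! p-prime k<p)
...   | inj₂ p∣[p-k]! = contradiction p∣[p-k]! (prime∤! p-prime (ℕ.∸-monoʳ-< 0<k (ℕ.<⇒≤ k<p)))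

-- Quotient rings

module _ {c ℓ} (R : CommutativeRing c ℓ) where
  open CommutativeRing R

  record IsIdeal {ℓ′} (I : Pred Carrier ℓ′) : Set (c ⊔ ℓ ⊔ ℓ′) where
    field
      respects : I Respects _≈_
      0∈       : I 0#
      +∈       : ∀ {x y} → I x → I y → I (x + y)
      -∈       : ∀ {x} → I x → I (- x)
      *∈       : ∀ {y} x → I y → I (x * y)

module Quotient {c ℓ ℓ′} (R : CommutativeRing c ℓ) {I : Pred (CommutativeRing.Carrier R) ℓ′}
                (isIdeal : IsIdeal R I) where
  open CommutativeRing R hiding (isCommutativeRing)
  open IsIdeal isIdeal
  open import Algebra.Properties.Ring ring using (x[y-z]≈xy-xz; [y-z]x≈yx-zx)
  open import Algebra.Properties.AbelianGroup +-abelianGroup using (⁻¹-anti-homo‿-; ⁻¹-∙-comm)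
  open import Algebra.Properties.Group +-group using (x≈y⇒x∙y⁻¹≈ε)
  open import Algebra.Properties.CommutativeSemigroup +-commutativeSemigroup using (interchange)
  open import Relation.Binary.Reasoning.Setoid setoid

  infix 4 _≈ᴵ_
  record _≈ᴵ_ (x y : Carrier) : Set ℓ′ where
    constructor ⟪_⟫
    field difference∈I : I (x - y)
  open _≈ᴵ_ public

  ≈⇒≈ᴵ : ∀ {x y} → x ≈ y → x ≈ᴵ y
  ≈⇒≈ᴵ x≈y = ⟪ respects (sym (x≈y⇒x∙y⁻¹≈ε x≈y)) 0∈ ⟫

  [x-y]+[y-z]≈x-z : ∀ x y z → (x - y) + (y - z) ≈ x - z
  [x-y]+[y-z]≈x-z x y z = begin
    (x - y) + (y - z)   ≈⟨ +-assoc x (- y) (y - z) ⟩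
    x + (- y + (y - z)) ≈⟨ +-congˡ (+-assoc (- y) y (- z)) ⟨
    x + ((- y + y) - z) ≈⟨ +-congˡ (+-congʳ (-‿inverseˡ y)) ⟩
    x + (0# - z)        ≈⟨ +-congˡ (+-identityˡ (- z)) ⟩
    x - z               ∎

  ≈ᴵ-sym : ∀ {x y} → x ≈ᴵ y → y ≈ᴵ x
  ≈ᴵ-sym {x} {y} ⟪ x-y∈I ⟫ = ⟪ respects (⁻¹-anti-homo‿- x y) (-∈ x-y∈I) ⟫

  ≈ᴵ-trans : ∀ {x y z} → x ≈ᴵ y → y ≈ᴵ z → x ≈ᴵ z
  ≈ᴵ-trans {x} {y} {z} ⟪ x-y∈I ⟫ ⟪ y-z∈I ⟫ = ⟪ respects ([x-y]+[y-z]≈x-z x y z) (+∈ x-y∈I y-z∈I) ⟫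

  +-congᴵ : ∀ {x x′ y y′} → x ≈ᴵ x′ → y ≈ᴵ y′ → x + y ≈ᴵ x′ + y′
  +-congᴵ {x} {x′} {y} {y′} ⟪ x-x′∈I ⟫ ⟪ y-y′∈I ⟫ = ⟪ respects regroup (+∈ x-x′∈I y-y′∈I) ⟫
    where
    regroup : (x - x′) + (y - y′) ≈ (x + y) - (x′ + y′)
    regroup = begin
      (x - x′) + (y - y′)     ≈⟨ interchange x (- x′) y (- y′) ⟩
      (x + y) + (- x′ - y′)   ≈⟨ +-congˡ (⁻¹-∙-comm x′ y′) ⟩
      (x + y) - (x′ + y′)     ∎

  -‿congᴵ : ∀ {x x′} → x ≈ᴵ x′ → - x ≈ᴵ - x′
  -‿congᴵ {x} {x′} ⟪ x-x′∈I ⟫ = ⟪ respects (sym (⁻¹-∙-comm x (- x′))) (-∈ x-x′∈I) ⟫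

  *-congᴵ : ∀ {x x′ y y′} → x ≈ᴵ x′ → y ≈ᴵ y′ → x * y ≈ᴵ x′ * y′
  *-congᴵ {x} {x′} {y} {y′} ⟪ x-x′∈I ⟫ ⟪ y-y′∈I ⟫ =
    ⟪ respects regroup (+∈ (*∈ x y-y′∈I) (respects (*-comm y′ (x - x′)) (*∈ y′ x-x′∈I))) ⟫
    where
    regroup : x * (y - y′) + (x - x′) * y′ ≈ x * y - x′ * y′
    regroup = begin
      x * (y - y′) + (x - x′) * y′          ≈⟨ +-cong (x[y-z]≈xy-xz x y y′) ([y-z]x≈yx-zx y′ x x′) ⟩
      (x * y - x * y′) + (x * y′ - x′ * y′) ≈⟨ [x-y]+[y-z]≈x-z (x * y) (x * y′) (x′ * y′) ⟩
      x * y - x′ * y′                        ∎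

  isCommutativeRing : IsCommutativeRing _≈ᴵ_ _+_ _*_ -_ 0# 1#
  isCommutativeRing = record
    { isRing = record
      { +-isAbelianGroup = record
        { isGroup = record
          { isMonoid = record
            { isSemigroup = record
              { isMagma = record
                { isEquivalence = record { refl = ≈⇒≈ᴵ refl ; sym = ≈ᴵ-sym ; trans = ≈ᴵ-trans }
                ; ∙-cong = +-congᴵ }
              ; assoc = λ x y z → ≈⇒≈ᴵ (+-assoc x y z) }
            ; identity = (λ x → ≈⇒≈ᴵ (+-identityˡ x)) , (λ x → ≈⇒≈ᴵ (+-identityʳ x)) }
          ; inverse = (λ x → ≈⇒≈ᴵ (-‿inverseˡ x)) , (λ x → ≈⇒≈ᴵ (-‿inverseʳ x))
          ; ⁻¹-cong = -‿congᴵ }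
        ; comm = λ x y → ≈⇒≈ᴵ (+-comm x y) }
      ; *-cong = *-congᴵ
      ; *-assoc = λ x y z → ≈⇒≈ᴵ (*-assoc x y z)
      ; *-identity = (λ x → ≈⇒≈ᴵ (*-identityˡ x)) , (λ x → ≈⇒≈ᴵ (*-identityʳ x))
      ; distrib = (λ x y z → ≈⇒≈ᴵ (distribˡ x y z)) , (λ x y z → ≈⇒≈ᴵ (distribʳ x y z)) }
    ; *-comm = λ x y → ≈⇒≈ᴵ (*-comm x y) }

  quotientRing : CommutativeRing c ℓ′
  quotientRing = record { isCommutativeRing = isCommutativeRing }

open Quotient using (⟪_⟫; difference∈I)

-- Powers of sums

module PowersOfSums {c ℓ} (S : CommutativeSemiring c ℓ) where
  open CommutativeSemiring S
  open import Algebra.Properties.Semiring.Exp semiring using (_^_)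
  open import Algebra.Properties.Semiring.Mult semiring
    using (_×_; ×-congʳ; ×-comm-*; ×-assoc-*; ×-assocˡ)
  open import Relation.Binary.Reasoning.Setoid setoid

  1#^n≈1# : ∀ n → 1# ^ n ≈ 1#
  1#^n≈1# zero    = refl
  1#^n≈1# (suc n) = trans (*-identityˡ (1# ^ n)) (1#^n≈1# n)

  ×-zeroʳ : ∀ n → n × 0# ≈ 0#
  ×-zeroʳ n = begin
    n × 0#          ≈⟨ ×-congʳ n (zeroˡ 0#) ⟨
    n × (0# * 0#)   ≈⟨ ×-assoc-* n 0# 0# ⟨
    (n × 0#) * 0#   ≈⟨ zeroʳ (n × 0#) ⟩
    0#              ∎

  first-order-binomial : ∀ {y d} → d * d ≈ 0# → ∀ k →
                         (y + d) ^ suc k ≈ y ^ suc k + suc k × (d * y ^ k)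
  first-order-binomial {y} {d} d²≈0 zero = begin
    (y + d) * 1#          ≈⟨ distribʳ 1# y d ⟩
    y * 1# + d * 1#       ≈⟨ +-congˡ (+-identityʳ (d * 1#)) ⟨
    y * 1# + 1 × (d * 1#) ∎
  first-order-binomial {y} {d} d²≈0 (suc k) = begin
    (y + d) * (y + d) ^ suc k                            ≈⟨ *-congˡ (first-order-binomial d²≈0 k) ⟩
    (y + d) * (Y + m × (d * W))                          ≈⟨ distribʳ _ y d ⟩
    y * (Y + m × (d * W)) + d * (Y + m × (d * W))        ≈⟨ +-cong (distribˡ y Y _) (distribˡ d Y _) ⟩
    (y * Y + y * (m × (d * W))) + (d * Y + d * (m × (d * W)))
      ≈⟨ +-cong (+-congˡ first-order) (+-congˡ second-order) ⟩
    (y * Y + m × (d * Y)) + (d * Y + 0#)                 ≈⟨ +-congˡ (+-identityʳ (d * Y)) ⟩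
    (y * Y + m × (d * Y)) + d * Y                        ≈⟨ +-assoc (y * Y) _ (d * Y) ⟩
    y * Y + (m × (d * Y) + d * Y)                        ≈⟨ +-congˡ (+-comm _ (d * Y)) ⟩
    y * Y + suc m × (d * Y)                              ∎
    where
    m = suc k
    W = y ^ k
    Y = y * W
    first-order : y * (m × (d * W)) ≈ m × (d * Y)
    first-order = begin
      y * (m × (d * W))   ≈⟨ ×-comm-* m y (d * W) ⟩
      m × (y * (d * W))   ≈⟨ ×-congʳ m (x∙yz≈y∙xz y d W) ⟩
      m × (d * (y * W))   ∎
      where open import Algebra.Properties.CommutativeSemigroup *-commutativeSemigroup using (x∙yz≈y∙xz)
    second-order : d * (m × (d * W)) ≈ 0#
    second-order = begin
      d * (m × (d * W))   ≈⟨ ×-comm-* m d (d * W) ⟩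
      m × (d * (d * W))   ≈⟨ ×-congʳ m (*-assoc d d W) ⟨
      m × ((d * d) * W)   ≈⟨ ×-congʳ m (*-congʳ d²≈0) ⟩
      m × (0# * W)        ≈⟨ ×-congʳ m (zeroˡ W) ⟩
      m × 0#              ≈⟨ ×-zeroʳ m ⟩
      0#                  ∎

  module Frobenius {n} (p-prime : Prime (suc n)) (p×≈0 : ∀ x → suc n × x ≈ 0#) where
    private
      p = suc n

    open import Algebra.Properties.CommutativeSemiring.Binomial S using (theorem; binomialTerm)
    open import Algebra.Properties.Semiring.Sum semiring using (sum; sum-cong-≋; sum-replicate-zero; sum-init-last)

    multiple-×≈0 : ∀ {m} x → p ℕ.∣ m → m × x ≈ 0#
    multiple-×≈0 {m} x (ℕ.divides q ≡.refl) = begin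
      (q ℕ.* p) × x   ≈⟨ ×-assocˡ x q p ⟨
      q × (p × x)     ≈⟨ ×-congʳ q (p×≈0 x) ⟩
      q × 0#          ≈⟨ ×-zeroʳ q ⟩
      0#              ∎

    freshman's-dream : ∀ x y → (x + y) ^ p ≈ x ^ p + y ^ p
    freshman's-dream x y = begin
      (x + y) ^ p                                           ≈⟨ theorem p x y ⟩
      t Fin.zero + sum (λ i → t (Fin.suc i))                ≈⟨ +-congˡ (sum-init-last (λ i → t (Fin.suc i))) ⟩
      t Fin.zero + (sum (λ i → t (Fin.suc (inject₁ i))) + t (Fin.suc (fromℕ n)))
        ≈⟨ +-cong first (+-cong middle last) ⟩
      y ^ p + (0# + x ^ p)                                  ≈⟨ +-congˡ (+-identityˡ (x ^ p)) ⟩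
      y ^ p + x ^ p                                         ≈⟨ +-comm (y ^ p) (x ^ p) ⟩
      x ^ p + y ^ p                                         ∎
      where
      t = binomialTerm x y p
      first : t Fin.zero ≈ y ^ p
      first = trans (+-identityʳ _) (*-identityˡ (y ^ p))
      last : t (Fin.suc (fromℕ n)) ≈ x ^ p
      last rewrite toℕ-fromℕ n | nCn≡1 p | ℕ.n∸n≡0 p = trans (+-identityʳ _) (*-identityʳ (x ^ p))
      middle : sum (λ i → t (Fin.suc (inject₁ i))) ≈ 0#
      middle = begin
        sum (λ i → t (Fin.suc (inject₁ i)))  ≈⟨ sum-cong-≋ (λ i → multiple-×≈0 _ (prime∣C p-prime z<s (1+i<p i))) ⟩
        sum {n} (λ _ → 0#)                    ≈⟨ sum-replicate-zero n ⟩
        0#                                    ∎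
        where
        1+i<p : ∀ i → suc (toℕ (inject₁ i)) < p
        1+i<p i = s<s (≡.subst (_< n) (≡.sym (toℕ-inject₁ i)) (toℕ<n i))

    fermat : ∀ m → (m × 1#) ^ p ≈ m × 1#
    fermat zero = begin
      0# * 0# ^ n  ≈⟨ zeroˡ _ ⟩
      0#           ∎
    fermat (suc m) = begin
      (1# + m × 1#) ^ p           ≈⟨ freshman's-dream 1# (m × 1#) ⟩
      1# ^ p + (m × 1#) ^ p       ≈⟨ +-cong (1#^n≈1# p) (fermat m) ⟩
      1# + m × 1#                 ∎

-- Integers modulo a prime

open ≡ using (refl; cong; cong₂; subst; subst₂)
open import Data.Product using (_×_; proj₁; proj₂)
open import Data.Integer as ℤ using (ℤ; +_; _+_; _*_; _-_; -_; _^_; 0ℤ; 1ℤ; -1ℤ)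
import Data.Integer.Properties as ℤ
open import Data.Integer.Divisibility.Signed
open import Data.Integer.Tactic.RingSolver using (solve-∀)
open import Data.List using (List; []; _∷_; length)
open import Data.List.Relation.Unary.All using (All; []; _∷_)
open import Data.List.Relation.Unary.AllPairs using (AllPairs; []; _∷_)

*-pres-∣ : ∀ {m n x y} → + m ∣ x → + n ∣ y → + (m ℕ.* n) ∣ x * y
*-pres-∣ {m} {n} {x} m∣x n∣y =
  subst (_∣ _) (≡.sym (ℤ.pos-* m n)) (∣-trans (*-monoˡ-∣ (+ n) m∣x) (*-monoʳ-∣ x n∣y))

m*n∣⇒m∣ : ∀ {m n x} → + (m ℕ.* n) ∣ x → + m ∣ x
m*n∣⇒m∣ {m} {n} = ∣-trans (divides (+ n) (≡.trans (ℤ.pos-* m n) (ℤ.*-comm (+ m) (+ n))))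

euclidsLemmaℤ : ∀ {p} → Prime p → ∀ x y → + p ∣ x * y → + p ∣ x ⊎ + p ∣ y
euclidsLemmaℤ {p} p-prime x y p∣xy
  with euclidsLemma ℤ.∣ x ∣ ℤ.∣ y ∣ p-prime (subst (p ℕ.∣_) (ℤ.abs-* x y) (∣⇒∣ᵤ p∣xy))
... | inj₁ p∣x = inj₁ (∣ᵤ⇒∣ p∣x)
... | inj₂ p∣y = inj₂ (∣ᵤ⇒∣ p∣y)

prime-∣-cancelˡ : ∀ {p} → Prime p → ∀ {c z} → ¬ + p ∣ c → + p ∣ c * z → + p ∣ z
prime-∣-cancelˡ p-prime {c} {z} p∤c p∣cz with euclidsLemmaℤ p-prime c z p∣cz
... | inj₁ p∣c = contradiction p∣c p∤c
... | inj₂ p∣z = p∣z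

prime²-∣-cancelˡ : ∀ {p} → Prime p → ∀ {c z} → ¬ + p ∣ c → + (p ℕ.* p) ∣ c * z → + (p ℕ.* p) ∣ z
prime²-∣-cancelˡ {p} p-prime {c} {z} p∤c p²∣cz with prime-∣-cancelˡ p-prime p∤c (m*n∣⇒m∣ p²∣cz)
... | divides q refl = subst (_∣ q * + p) (≡.sym (ℤ.pos-* p p)) (*-monoˡ-∣ (+ p) p∣q)
  where
  instance _ = prime⇒nonZero p-prime
  p∣q : + p ∣ q
  p∣q = prime-∣-cancelˡ p-prime p∤c
          (*-cancelʳ-∣ (+ p) (subst₂ _∣_ (ℤ.pos-* p p) (≡.sym (ℤ.*-assoc c q (+ p))) p²∣cz))

ℤ-∣-isIdeal : ∀ m → IsIdeal ℤ.+-*-commutativeRing (+ m ∣_)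
ℤ-∣-isIdeal m = record
  { respects = λ { refl m∣x → m∣x }
  ; 0∈       = divides 0ℤ refl
  ; +∈       = ∣m∣n⇒∣m+n
  ; -∈       = ∣m⇒∣-m
  ; *∈       = λ x → ∣n⇒∣m*n x
  }

ℤ/_ : ℕ → CommutativeRing 0ℓ 0ℓ
ℤ/ m = Quotient.quotientRing ℤ.+-*-commutativeRing (ℤ-∣-isIdeal m)

fermat-ℤ : ∀ {p} → Prime p → ∀ c → + p ∣ (+ c) ^ p - + c
fermat-ℤ {zero}  p-prime = contradiction p-prime ¬prime[0]
fermat-ℤ {suc n} p-prime c =
  subst₂ (λ x y → + p ∣ x - y) (≡.trans (^′≡^ (c · 1ℤ) p) (cong (_^ p) (c·1≡c c))) (c·1≡c c)
         (difference∈I (fermat c))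
  where
  p = suc n
  open CommutativeRing (ℤ/ p) using (_≈_; semiring; commutativeSemiring)
  open import Algebra.Properties.Semiring.Mult semiring using () renaming (_×_ to _·_)
  open import Algebra.Properties.Semiring.Exp semiring using () renaming (_^_ to _^′_)

  c·1≡c : ∀ m → m · 1ℤ ≡ + m
  c·1≡c zero    = refl
  c·1≡c (suc m) = cong (λ x → 1ℤ + x) (c·1≡c m)

  ·≡* : ∀ k x → k · x ≡ + k * x
  ·≡* zero    x = refl
  ·≡* (suc k) x = ≡.trans (cong (λ y → x + y) (·≡* k x)) (≡.sym (ℤ.suc-* (+ k) x))

  ^′≡^ : ∀ x k → x ^′ k ≡ x ^ k
  ^′≡^ x zero    = refl
  ^′≡^ x (suc k) = cong (x *_) (^′≡^ x k)

  p·≈0 : ∀ x → p · x ≈ 0ℤ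
  p·≈0 x = ⟪ subst (+ p ∣_) (≡.sym (≡.trans (ℤ.+-identityʳ (p · x)) (·≡* p x))) (∣m⇒∣m*n x ∣-refl) ⟫

  open PowersOfSums commutativeSemiring
  open Frobenius p-prime p·≈0 using (fermat)

>⇒∤ℤ : ∀ {p k} → 0 < k → k < p → ¬ + p ∣ + k
>⇒∤ℤ {k = suc _} _ k<p p∣k = ℕ.>⇒∤ k<p (∣⇒∣ᵤ p∣k)

fermat-unit : ∀ {n} → Prime (suc n) → ∀ c → ¬ + suc n ∣ + c → + suc n ∣ (+ c) ^ n - 1ℤ
fermat-unit {n} p-prime c p∤c =
  prime-∣-cancelˡ p-prime p∤c (subst (+ suc n ∣_) (factor (+ c) ((+ c) ^ n)) (fermat-ℤ p-prime c))
  where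
  factor : ∀ x y → x * y - x ≡ x * (y - 1ℤ)
  factor = solve-∀

-- Euler's criterion

-- Polynomials are coefficient lists, constant term first.
eval : List ℤ → ℤ → ℤ
eval []       x = 0ℤ
eval (c ∷ cs) x = c + x * eval cs x

-- The quotient of c ∷ cs by X − r, by synthetic division.
deflate : ℤ → List ℤ → List ℤ
deflate r []       = []
deflate r (c ∷ cs) = eval (c ∷ cs) r ∷ deflate r cs

length-deflate : ∀ r cs → length (deflate r cs) ≡ length cs
length-deflate r []       = refl
length-deflate r (c ∷ cs) = cong suc (length-deflate r cs)

eval-deflate : ∀ c cs x r → eval (c ∷ cs) x ≡ eval (c ∷ cs) r + (x - r) * eval (deflate r cs) x
eval-deflate c []       x r = step c x r
  where
  step : ∀ c x r → c + x * 0ℤ ≡ c + r * 0ℤ + (x - r) * 0ℤ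
  step = solve-∀
eval-deflate c (d ∷ ds) x r rewrite eval-deflate d ds x r = step c x r (eval (d ∷ ds) r) (eval (deflate r ds) x)
  where
  step : ∀ c x r e q → c + x * (e + (x - r) * q) ≡ c + r * e + (x - r) * (e + x * q)
  step = solve-∀

lagrange : ∀ {p} → Prime p → ∀ g rs → length g ≤ length rs →
           AllPairs (λ r s → ¬ + p ∣ s - r) rs → All (λ r → + p ∣ eval g r) rs →
           ∀ x → + p ∣ eval g x
lagrange p-prime []       rs       _         _                  _              x = divides 0ℤ refl
lagrange {p} p-prime (c ∷ cs) (r ∷ rs) (s≤s len) (r≉rs ∷ distinct) (root ∷ roots) x =
  subst (+ p ∣_) (≡.sym (eval-deflate c cs x r))
    (∣m∣n⇒∣m+n root (∣n⇒∣m*n (x - r)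
      (lagrange p-prime (deflate r cs) rs (subst (_≤ length rs) (≡.sym (length-deflate r cs)) len) distinct
        (All.zipWith deflated-root (r≉rs , roots)) x)))
  where
  import Data.List.Relation.Unary.All as All
  deflated-root : ∀ {s} → ¬ + p ∣ s - r × + p ∣ eval (c ∷ cs) s → + p ∣ eval (deflate r cs) s
  deflated-root {s} (s≉r , gs≡0) = prime-∣-cancelˡ p-prime s≉r
    (subst (+ p ∣_) (difference (eval-deflate c cs s r)) (∣m∣n⇒∣m-n gs≡0 root))
    where
    difference : ∀ {a b e} → e ≡ a + b → e - a ≡ b
    difference {a} {b} refl = cancel a b
      where cancel : ∀ a b → a + b - a ≡ b
            cancel = solve-∀

X^_ : ℕ → List ℤ
X^ zero  = 1ℤ ∷ []
X^ suc k = 0ℤ ∷ X^ k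

eval-X^ : ∀ k x → eval (X^ k) x ≡ x ^ k
eval-X^ zero    x = cong (λ y → 1ℤ + y) (ℤ.*-zeroʳ x)
eval-X^ (suc k) x = ≡.trans (ℤ.+-identityˡ _) (cong (x *_) (eval-X^ k x))

length-X^ : ∀ k → length (X^ k) ≡ suc k
length-X^ zero    = refl
length-X^ (suc k) = cong suc (length-X^ k)

squares : ℕ → List ℤ
squares zero    = []
squares (suc k) = + suc k * + suc k ∷ squares k

length-squares : ∀ k → length (squares k) ≡ k
length-squares zero    = refl
length-squares (suc k) = cong suc (length-squares k)

All-squares : ∀ {ℓ} {P : Pred ℤ ℓ} k → (∀ {i} → 0 < i → i ≤ k → P (+ i * + i)) → All P (squares k)
All-squares zero    P[i²] = []
All-squares (suc k) P[i²] = P[i²] z<s ℕ.≤-refl ∷ All-squares k (λ 0<i i≤k → P[i²] 0<i (ℕ.m≤n⇒m≤1+n i≤k))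

square-difference : ∀ {p} → Prime p → ∀ {i j} → 0 < i → i < j → i ℕ.+ j < p → ¬ + p ∣ + i * + i - + j * + j
square-difference {p} p-prime {i} {j} 0<i i<j i+j<p p∣i²-j²
  with euclidsLemmaℤ p-prime (+ j - + i) (+ i + + j) (subst (+ p ∣_) (factor (+ i) (+ j)) (∣m⇒∣-m p∣i²-j²))
  where
  factor : ∀ i j → - (i * i - j * j) ≡ (j - i) * (i + j)
  factor = solve-∀
... | inj₁ p∣j-i = >⇒∤ℤ (ℕ.m<n⇒0<n∸m i<j) (ℕ.≤-<-trans (ℕ.m∸n≤m j i) (ℕ.≤-<-trans (ℕ.m≤n+m j i) i+j<p))
                     (subst (+ p ∣_) (≡.trans (ℤ.[+m]-[+n]≡m⊖n j i) (ℤ.⊖-≥ (ℕ.<⇒≤ i<j))) p∣j-i)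
... | inj₂ p∣i+j = >⇒∤ℤ (ℕ.<-≤-trans 0<i (ℕ.m≤m+n i j)) i+j<p p∣i+j

squares-distinct : ∀ {p} → Prime p → ∀ k → k ℕ.+ k < p → AllPairs (λ r s → ¬ + p ∣ s - r) (squares k)
squares-distinct p-prime zero    _    = []
squares-distinct p-prime (suc k) 2k<p =
  All-squares k (λ 0<i i≤k → square-difference p-prime 0<i (s≤s i≤k)
                               (ℕ.≤-<-trans (ℕ.+-monoˡ-≤ (suc k) (ℕ.m≤n⇒m≤1+n i≤k)) 2k<p))
  ∷ squares-distinct p-prime k (ℕ.≤-<-trans (ℕ.+-mono-≤ (ℕ.n≤1+n k) (ℕ.n≤1+n k)) 2k<p)

square-^ : ∀ x n → (x * x) ^ n ≡ x ^ (n ℕ.+ n)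
square-^ x n = ≡.trans (^-square n) (≡.sym (ℤ.^-distribˡ-+-* x n n))
  where
  regroup : ∀ x y → x * x * (y * y) ≡ x * y * (x * y)
  regroup = solve-∀
  ^-square : ∀ n → (x * x) ^ n ≡ x ^ n * x ^ n
  ^-square zero    = refl
  ^-square (suc n) = ≡.trans (cong ((x * x) *_) (^-square n)) (regroup x (x ^ n))

-- Otherwise X^h − 1 would have the h + 1 roots 1², …, h², D, pairwise distinct modulo p.
nonresidue^h≢1 : ∀ {p h} → Prime p → p ≡ suc (h ℕ.+ h) → ∀ D →
                 (∀ x → ¬ + p ∣ x * x - + D) → ¬ + p ∣ (+ D) ^ h - 1ℤ
nonresidue^h≢1 {h = zero}  p-prime refl = contradiction p-prime ¬prime[1]
nonresidue^h≢1 {p} {suc k} p-prime refl D nonresidue p∣D^h-1 =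
  prime∤1 p-prime (∣⇒∣ᵤ (lagrange p-prime g (+ D ∷ squares h) length-g≤ distinct roots 0ℤ))
  where
  h = suc k
  g = -1ℤ ∷ X^ k
  eval-g : ∀ x → eval g x ≡ x ^ h - 1ℤ
  eval-g x = ≡.trans (cong (λ y → -1ℤ + x * y) (eval-X^ k x)) (ℤ.+-comm -1ℤ (x ^ h))
  square-root : ∀ {i} → 0 < i → i ≤ h → + p ∣ eval g (+ i * + i)
  square-root {i} 0<i i≤h =
    subst (+ p ∣_) (≡.sym (≡.trans (eval-g (+ i * + i)) (cong (_- 1ℤ) (square-^ (+ i) h))))
          (fermat-unit p-prime i (>⇒∤ℤ 0<i (s≤s (ℕ.≤-trans i≤h (ℕ.m≤m+n h h)))))
  length-g≤ : length g ≤ length (+ D ∷ squares h)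
  length-g≤ = ℕ.≤-reflexive (cong suc (≡.trans (length-X^ k) (≡.sym (length-squares h))))
  distinct : AllPairs (λ r s → ¬ + p ∣ s - r) (+ D ∷ squares h)
  distinct = All-squares h (λ {i} _ _ → nonresidue (+ i)) ∷ squares-distinct p-prime h (ℕ.n<1+n (h ℕ.+ h))
  roots : All (λ r → + p ∣ eval g r) (+ D ∷ squares h)
  roots = subst (+ p ∣_) (≡.sym (eval-g (+ D))) p∣D^h-1 ∷ All-squares h square-root

euler-nonresidue : ∀ {p h} → Prime p → p ≡ suc (h ℕ.+ h) → ∀ D → ¬ + p ∣ + D →
                   (∀ x → ¬ + p ∣ x * x - + D) → + p ∣ (+ D) ^ h + 1ℤ
euler-nonresidue {p} {h} p-prime refl D p∤D nonresidue =
  [ (λ p∣E-1 → contradiction p∣E-1 (nonresidue^h≢1 {h = h} p-prime refl D nonresidue)) , id ]′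
    (euclidsLemmaℤ p-prime (E - 1ℤ) (E + 1ℤ) p∣[E-1][E+1])
  where
  E = (+ D) ^ h
  difference-of-squares : ∀ e → e * e - 1ℤ ≡ (e - 1ℤ) * (e + 1ℤ)
  difference-of-squares = solve-∀
  p∣[E-1][E+1] : + p ∣ (E - 1ℤ) * (E + 1ℤ)
  p∣[E-1][E+1] = subst (+ p ∣_) (≡.trans (cong (_- 1ℤ) (ℤ.^-distribˡ-+-* (+ D) h h)) (difference-of-squares E))
                       (fermat-unit p-prime D p∤D)

module ℤ[α] (a b : ℤ) where
  open ZAlpha a b public

  infix 25 ⊝_
  ⊝_ : Zα → Zα
  ⊝ (u , v) = (- u , - v)

  0α : Zα
  0α = (0ℤ , 0ℤ)

  -- The other root a − α of f.
  β : Zα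
  β = (a , -1ℤ)

  -- Identities in ℤ[α] are checked on coordinates: at-1 and at-α compare the coefficients of 1 and α.
  ⊗-comm : ∀ x y → x ⊗ y ≡ y ⊗ x
  ⊗-comm (u₁ , v₁) (u₂ , v₂) = cong₂ _,_ (at-1 b u₁ v₁ u₂ v₂) (at-α a u₁ v₁ u₂ v₂)
    where
    at-1 : ∀ b u₁ v₁ u₂ v₂ → u₁ * u₂ + b * (v₁ * v₂) ≡ u₂ * u₁ + b * (v₂ * v₁)
    at-1 = solve-∀
    at-α : ∀ a u₁ v₁ u₂ v₂ → u₁ * v₂ + v₁ * u₂ + a * (v₁ * v₂) ≡ u₂ * v₁ + v₂ * u₁ + a * (v₂ * v₁)
    at-α = solve-∀

  ⊗-assoc : ∀ x y z → (x ⊗ y) ⊗ z ≡ x ⊗ (y ⊗ z)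
  ⊗-assoc (u₁ , v₁) (u₂ , v₂) (u₃ , v₃) = cong₂ _,_ (at-1 a b u₁ v₁ u₂ v₂ u₃ v₃) (at-α a b u₁ v₁ u₂ v₂ u₃ v₃)
    where
    at-1 : ∀ a b u₁ v₁ u₂ v₂ u₃ v₃ →
      (u₁ * u₂ + b * (v₁ * v₂)) * u₃ + b * ((u₁ * v₂ + v₁ * u₂ + a * (v₁ * v₂)) * v₃)
      ≡ u₁ * (u₂ * u₃ + b * (v₂ * v₃)) + b * (v₁ * (u₂ * v₃ + v₂ * u₃ + a * (v₂ * v₃)))
    at-1 = solve-∀
    at-α : ∀ a b u₁ v₁ u₂ v₂ u₃ v₃ →
      (u₁ * u₂ + b * (v₁ * v₂)) * v₃ + (u₁ * v₂ + v₁ * u₂ + a * (v₁ * v₂)) * u₃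
        + a * ((u₁ * v₂ + v₁ * u₂ + a * (v₁ * v₂)) * v₃)
      ≡ u₁ * (u₂ * v₃ + v₂ * u₃ + a * (v₂ * v₃)) + v₁ * (u₂ * u₃ + b * (v₂ * v₃))
        + a * (v₁ * (u₂ * v₃ + v₂ * u₃ + a * (v₂ * v₃)))
    at-α = solve-∀

  ⊗-identityˡ : ∀ x → one ⊗ x ≡ x
  ⊗-identityˡ (u , v) = cong₂ _,_ (at-1 b u v) (at-α a u v)
    where
    at-1 : ∀ b u v → 1ℤ * u + b * (0ℤ * v) ≡ u
    at-1 = solve-∀
    at-α : ∀ a u v → 1ℤ * v + 0ℤ * u + a * (0ℤ * v) ≡ v
    at-α = solve-∀

  ⊗-distribʳ-⊕ : ∀ x y z → (y ⊕ z) ⊗ x ≡ (y ⊗ x) ⊕ (z ⊗ x)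
  ⊗-distribʳ-⊕ (u₁ , v₁) (u₂ , v₂) (u₃ , v₃) = cong₂ _,_ (at-1 b u₁ v₁ u₂ v₂ u₃ v₃) (at-α a u₁ v₁ u₂ v₂ u₃ v₃)
    where
    at-1 : ∀ b u₁ v₁ u₂ v₂ u₃ v₃ →
      (u₂ + u₃) * u₁ + b * ((v₂ + v₃) * v₁) ≡ (u₂ * u₁ + b * (v₂ * v₁)) + (u₃ * u₁ + b * (v₃ * v₁))
    at-1 = solve-∀
    at-α : ∀ a u₁ v₁ u₂ v₂ u₃ v₃ →
      (u₂ + u₃) * v₁ + (v₂ + v₃) * u₁ + a * ((v₂ + v₃) * v₁)
      ≡ (u₂ * v₁ + v₂ * u₁ + a * (v₂ * v₁)) + (u₃ * v₁ + v₃ * u₁ + a * (v₃ * v₁))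
    at-α = solve-∀

  isCommutativeRing : IsCommutativeRing _≡_ _⊕_ _⊗_ ⊝_ 0α one
  isCommutativeRing = record
    { isRing = record
      { +-isAbelianGroup = record
        { isGroup = record
          { isMonoid = record
            { isSemigroup = record
              { isMagma = record { isEquivalence = ≡.isEquivalence ; ∙-cong = cong₂ _⊕_ }
              ; assoc = λ { (u₁ , v₁) (u₂ , v₂) (u₃ , v₃) → cong₂ _,_ (ℤ.+-assoc u₁ u₂ u₃) (ℤ.+-assoc v₁ v₂ v₃) } }
            ; identity = (λ { (u , v) → cong₂ _,_ (ℤ.+-identityˡ u) (ℤ.+-identityˡ v) })
                       , (λ { (u , v) → cong₂ _,_ (ℤ.+-identityʳ u) (ℤ.+-identityʳ v) }) }
          ; inverse = (λ { (u , v) → cong₂ _,_ (ℤ.+-inverseˡ u) (ℤ.+-inverseˡ v) })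
                    , (λ { (u , v) → cong₂ _,_ (ℤ.+-inverseʳ u) (ℤ.+-inverseʳ v) })
          ; ⁻¹-cong = cong ⊝_ }
        ; comm = λ { (u₁ , v₁) (u₂ , v₂) → cong₂ _,_ (ℤ.+-comm u₁ u₂) (ℤ.+-comm v₁ v₂) } }
      ; *-cong = cong₂ _⊗_
      ; *-assoc = ⊗-assoc
      ; *-identity = ⊗-identityˡ , λ x → ≡.trans (⊗-comm x one) (⊗-identityˡ x)
      ; distrib = (λ x y z → ≡.trans (⊗-comm x (y ⊕ z))
                                     (≡.trans (⊗-distribʳ-⊕ x y z) (cong₂ _⊕_ (⊗-comm y x) (⊗-comm z x))))
                , ⊗-distribʳ-⊕ }
    ; *-comm = ⊗-comm }

  commutativeRing : CommutativeRing 0ℓ 0ℓ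
  commutativeRing = record { isCommutativeRing = isCommutativeRing }

  open CommutativeRing commutativeRing public
    using ()
    renaming ( +-assoc to ⊕-assoc; +-identityˡ to ⊕-identityˡ; +-identityʳ to ⊕-identityʳ
             ; *-identityʳ to ⊗-identityʳ; zeroʳ to ⊗-zeroʳ; distribʳ to ⊗-distribʳ)
  open import Algebra.Properties.AbelianGroup (CommutativeRing.+-abelianGroup commutativeRing) using (xyx⁻¹≈y)
  open import Algebra.Properties.Group (CommutativeRing.+-group commutativeRing) using (⁻¹-involutive)

  y⊕[x⊖y]≡x : ∀ x y → y ⊕ (x ⊖ y) ≡ x
  y⊕[x⊖y]≡x x y = ≡.trans (≡.sym (⊕-assoc y x (⊝ y))) (xyx⁻¹≈y y x)

  [⊝x⊕y]⊕x≡y : ∀ x y → ((⊝ x) ⊕ y) ⊕ x ≡ y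
  [⊝x⊕y]⊕x≡y x y = ≡.trans (cong (((⊝ x) ⊕ y) ⊕_) (≡.sym (⁻¹-involutive x))) (xyx⁻¹≈y (⊝ x) y)

  ι-* : ∀ x y → ι (x * y) ≡ ι x ⊗ ι y
  ι-* x y = cong₂ _,_ (at-1 b x y) (at-α a x y)
    where
    at-1 : ∀ b x y → x * y ≡ x * y + b * (0ℤ * 0ℤ)
    at-1 = solve-∀
    at-α : ∀ a x y → 0ℤ ≡ x * 0ℤ + 0ℤ * y + a * (0ℤ * 0ℤ)
    at-α = solve-∀

  ι-⊗ : ∀ c u v → ι c ⊗ (u , v) ≡ (c * u , c * v)
  ι-⊗ c u v = cong₂ _,_ (at-1 b c u v) (at-α a c u v)
    where
    at-1 : ∀ b c u v → c * u + b * (0ℤ * v) ≡ c * u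
    at-1 = solve-∀
    at-α : ∀ a c u v → c * v + 0ℤ * u + a * (0ℤ * v) ≡ c * v
    at-α = solve-∀

  ⊗-ι-1 : ∀ x → x ⊗ ι -1ℤ ≡ ⊝ x
  ⊗-ι-1 (u , v) = cong₂ _,_ (at-1 b u v) (at-α a u v)
    where
    at-1 : ∀ b u v → u * -1ℤ + b * (v * 0ℤ) ≡ - u
    at-1 = solve-∀
    at-α : ∀ a u v → u * 0ℤ + v * -1ℤ + a * (v * 0ℤ) ≡ - v
    at-α = solve-∀

  ι-^ : ∀ x n → ι (x ^ n) ≡ ι x ^α n
  ι-^ x zero    = refl
  ι-^ x (suc n) = ≡.trans (ι-* x (x ^ n)) (cong (ι x ⊗_) (ι-^ x n))

  ^α-+ : ∀ x m n → x ^α (m ℕ.+ n) ≡ (x ^α m) ⊗ (x ^α n)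
  ^α-+ x zero    n = ≡.sym (⊗-identityˡ (x ^α n))
  ^α-+ x (suc m) n = ≡.trans (cong (x ⊗_) (^α-+ x m n)) (≡.sym (⊗-assoc x (x ^α m) (x ^α n)))

  ^α-* : ∀ x m n → x ^α (m ℕ.* n) ≡ (x ^α n) ^α m
  ^α-* x zero    n = refl
  ^α-* x (suc m) n = ≡.trans (^α-+ x n (m ℕ.* n)) (cong ((x ^α n) ⊗_) (^α-* x m n))

  ⊗-^α : ∀ x y n → (x ⊗ y) ^α n ≡ (x ^α n) ⊗ (y ^α n)
  ⊗-^α x y zero    = ≡.sym (⊗-identityˡ one)
  ⊗-^α x y (suc n) = ≡.trans (cong ((x ⊗ y) ⊗_) (⊗-^α x y n)) (interchange x y (x ^α n) (y ^α n))
    where open import Algebra.Properties.CommutativeSemigroup (CommutativeRing.*-commutativeSemigroup commutativeRing)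
            using (interchange)

  one-^α : ∀ n → one ^α n ≡ one
  one-^α zero    = refl
  one-^α (suc n) = ≡.trans (⊗-identityˡ (one ^α n)) (one-^α n)

  -- Conjugation u + vα ↦ u + vβ.
  σ : Zα → Zα
  σ (u , v) = (u + a * v , - v)

  σ-involutive : ∀ x → σ (σ x) ≡ x
  σ-involutive (u , v) = cong₂ _,_ (at-1 a u v) (ℤ.neg-involutive v)
    where
    at-1 : ∀ a u v → u + a * v + a * (- v) ≡ u
    at-1 = solve-∀

  σ-⊕ : ∀ x y → σ (x ⊕ y) ≡ σ x ⊕ σ y
  σ-⊕ (u₁ , v₁) (u₂ , v₂) = cong₂ _,_ (at-1 a u₁ v₁ u₂ v₂) (ℤ.neg-distrib-+ v₁ v₂)
    where
    at-1 : ∀ a u₁ v₁ u₂ v₂ → u₁ + u₂ + a * (v₁ + v₂) ≡ u₁ + a * v₁ + (u₂ + a * v₂)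
    at-1 = solve-∀

  σ-⊝ : ∀ x → σ (⊝ x) ≡ ⊝ σ x
  σ-⊝ (u , v) = cong₂ _,_ (at-1 a u v) refl
    where
    at-1 : ∀ a u v → - u + a * - v ≡ - (u + a * v)
    at-1 = solve-∀

  σ-⊗ : ∀ x y → σ (x ⊗ y) ≡ σ x ⊗ σ y
  σ-⊗ (u₁ , v₁) (u₂ , v₂) = cong₂ _,_ (at-1 a b u₁ v₁ u₂ v₂) (at-α a b u₁ v₁ u₂ v₂)
    where
    at-1 : ∀ a b u₁ v₁ u₂ v₂ →
      u₁ * u₂ + b * (v₁ * v₂) + a * (u₁ * v₂ + v₁ * u₂ + a * (v₁ * v₂))
      ≡ (u₁ + a * v₁) * (u₂ + a * v₂) + b * (- v₁ * - v₂)
    at-1 = solve-∀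
    at-α : ∀ a b u₁ v₁ u₂ v₂ →
      - (u₁ * v₂ + v₁ * u₂ + a * (v₁ * v₂))
      ≡ (u₁ + a * v₁) * - v₂ + - v₁ * (u₂ + a * v₂) + a * (- v₁ * - v₂)
    at-α = solve-∀

  σ-ι : ∀ c → σ (ι c) ≡ ι c
  σ-ι c = cong₂ _,_ (at-1 a c) refl
    where
    at-1 : ∀ a c → c + a * 0ℤ ≡ c
    at-1 = solve-∀

  σ-^α : ∀ x n → σ (x ^α n) ≡ σ x ^α n
  σ-^α x zero    = σ-ι 1ℤ
  σ-^α x (suc n) = ≡.trans (σ-⊗ x (x ^α n)) (cong (σ x ⊗_) (σ-^α x n))

  σ-α : σ α ≡ β
  σ-α = cong₂ _,_ (at-1 a) refl
    where
    at-1 : ∀ a → 0ℤ + a * 1ℤ ≡ a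
    at-1 = solve-∀

  β^n≡σ[α^n] : ∀ n → β ^α n ≡ σ (α ^α n)
  β^n≡σ[α^n] n = ≡.trans (cong (_^α n) (≡.sym σ-α)) (≡.sym (σ-^α α n))

  f-σ : ∀ x → f (σ x) ≡ σ (f x)
  f-σ x = ≡.sym (begin
    σ (((x ⊗ x) ⊖ (ι a ⊗ x)) ⊖ ι b)                   ≡⟨ σ-⊕ ((x ⊗ x) ⊖ (ι a ⊗ x)) (⊝ ι b) ⟩
    σ ((x ⊗ x) ⊖ (ι a ⊗ x)) ⊕ σ (⊝ ι b)               ≡⟨ cong₂ _⊕_ (σ-⊕ (x ⊗ x) (⊝ (ι a ⊗ x)))
                                                                    (≡.trans (σ-⊝ (ι b)) (cong ⊝_ (σ-ι b))) ⟩
    (σ (x ⊗ x) ⊕ σ (⊝ (ι a ⊗ x))) ⊖ ι b               ≡⟨ cong (λ y → (σ (x ⊗ x) ⊕ y) ⊖ ι b) (σ-⊝ (ι a ⊗ x)) ⟩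
    (σ (x ⊗ x) ⊖ σ (ι a ⊗ x)) ⊖ ι b                   ≡⟨ cong₂ (λ y z → (y ⊖ z) ⊖ ι b) (σ-⊗ x x)
                                                               (≡.trans (σ-⊗ (ι a) x) (cong (_⊗ σ x) (σ-ι a))) ⟩
    ((σ x ⊗ σ x) ⊖ (ι a ⊗ σ x)) ⊖ ι b                 ∎)
    where open ≡.≡-Reasoning

  -- δ = β − α = a − 2α, a square root of a² + 4b.
  δ : Zα
  δ = (a , - + 2)

  -- f x = (x − α)(x − β) and x − α = (x − β) + δ.
  f-expand : ∀ x → f x ≡ ((x ⊖ β) ⊗ (x ⊖ β)) ⊕ (δ ⊗ (x ⊖ β))
  f-expand (u , v) = cong₂ _,_ (at-1 a b u v) (at-α a b u v)
    where
    at-1 : ∀ a b u v →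
      u * u + b * (v * v) - (a * u + b * (0ℤ * v)) - b
      ≡ (u - a) * (u - a) + b * ((v - -1ℤ) * (v - -1ℤ)) + (a * (u - a) + b * (- + 2 * (v - -1ℤ)))
    at-1 = solve-∀
    at-α : ∀ a b u v →
      u * v + v * u + a * (v * v) - (a * v + 0ℤ * u + a * (0ℤ * v)) - 0ℤ
      ≡ (u - a) * (v - -1ℤ) + (v - -1ℤ) * (u - a) + a * ((v - -1ℤ) * (v - -1ℤ))
        + (a * (v - -1ℤ) + - + 2 * (u - a) + a * (- + 2 * (v - -1ℤ)))
    at-α = solve-∀

  δ-square : δ ⊗ δ ≡ ι (a * a + + 4 * b)
  δ-square = cong₂ _,_ (at-1 a b) (at-α a)
    where
    at-1 : ∀ a b → a * a + b * (- + 2 * - + 2) ≡ a * a + + 4 * b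
    at-1 = solve-∀
    at-α : ∀ a → a * - + 2 + - + 2 * a + a * (- + 2 * - + 2) ≡ 0ℤ
    at-α = solve-∀

  ι-a≡δ+2α : ι a ≡ δ ⊕ (ι (+ 2) ⊗ α)
  ι-a≡δ+2α = cong₂ _,_ (at-1 a b) (at-α a)
    where
    at-1 : ∀ a b → a ≡ a + (+ 2 * 0ℤ + b * (0ℤ * 1ℤ))
    at-1 = solve-∀
    at-α : ∀ a → 0ℤ ≡ - + 2 + (+ 2 * 1ℤ + 0ℤ * 0ℤ + a * (0ℤ * 1ℤ))
    at-α = solve-∀

  ι-a+δ≡2β : ι a ⊕ δ ≡ ι (+ 2) ⊗ β
  ι-a+δ≡2β = cong₂ _,_ (at-1 a b) (at-α a)
    where
    at-1 : ∀ a b → a + a ≡ + 2 * a + b * (0ℤ * -1ℤ)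
    at-1 = solve-∀
    at-α : ∀ a → 0ℤ + - + 2 ≡ + 2 * -1ℤ + 0ℤ * a + a * (0ℤ * -1ℤ)
    at-α = solve-∀

  β⊗α≡ι[-b] : β ⊗ α ≡ ι (- b)
  β⊗α≡ι[-b] = cong₂ _,_ (at-1 a b) (at-α a)
    where
    at-1 : ∀ a b → a * 0ℤ + b * (-1ℤ * 1ℤ) ≡ - b
    at-1 = solve-∀
    at-α : ∀ a → a * 1ℤ + -1ℤ * 0ℤ + a * (-1ℤ * 1ℤ) ≡ 0ℤ
    at-α = solve-∀

  α^suc≡U : ∀ n → α ^α suc n ≡ (b * U a b n , U a b (suc n))
  α^suc≡U zero    = cong₂ _,_ (at-1 a b) (at-α a)
    where
    at-1 : ∀ a b → 0ℤ * 1ℤ + b * (1ℤ * 0ℤ) ≡ b * 0ℤ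
    at-1 = solve-∀
    at-α : ∀ a → 0ℤ * 0ℤ + 1ℤ * 1ℤ + a * (1ℤ * 0ℤ) ≡ 1ℤ
    at-α = solve-∀
  α^suc≡U (suc n) =
    ≡.trans (cong (α ⊗_) (α^suc≡U n)) (cong₂ _,_ (at-1 a b (U a b n) (U a b (suc n))) (at-α a b (U a b n) (U a b (suc n))))
    where
    at-1 : ∀ a b u u′ → 0ℤ * (b * u) + b * (1ℤ * u′) ≡ b * u′
    at-1 = solve-∀
    at-α : ∀ a b u u′ → 0ℤ * u′ + 1ℤ * (b * u) + a * (1ℤ * u′) ≡ a * u′ + b * u
    at-α = solve-∀

  infix 4 _∣ᵅ_
  _∣ᵅ_ : ℕ → Zα → Set
  m ∣ᵅ x = + m ∣ proj₁ x × + m ∣ proj₂ x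

  ∣ᵅ-isIdeal : ∀ m → IsIdeal commutativeRing (m ∣ᵅ_)
  ∣ᵅ-isIdeal m = record
    { respects = λ { refl m∣x → m∣x }
    ; 0∈       = divides 0ℤ refl , divides 0ℤ refl
    ; +∈       = λ { (m∣u₁ , m∣v₁) (m∣u₂ , m∣v₂) → ∣m∣n⇒∣m+n m∣u₁ m∣u₂ , ∣m∣n⇒∣m+n m∣v₁ m∣v₂ }
    ; -∈       = λ { (m∣u , m∣v) → ∣m⇒∣-m m∣u , ∣m⇒∣-m m∣v }
    ; *∈       = λ { (u₁ , v₁) (m∣u₂ , m∣v₂) →
                   ∣m∣n⇒∣m+n (∣n⇒∣m*n u₁ m∣u₂) (∣n⇒∣m*n b (∣n⇒∣m*n v₁ m∣v₂))
                 , ∣m∣n⇒∣m+n (∣m∣n⇒∣m+n (∣n⇒∣m*n u₁ m∣v₂) (∣n⇒∣m*n v₁ m∣u₂)) (∣n⇒∣m*n a (∣n⇒∣m*n v₁ m∣v₂)) }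
    }

  ∣ᵅ-* : ∀ {m n x y} → m ∣ᵅ x → n ∣ᵅ y → (m ℕ.* n) ∣ᵅ (x ⊗ y)
  ∣ᵅ-* {x = u₁ , v₁} {u₂ , v₂} (m∣u₁ , m∣v₁) (n∣u₂ , n∣v₂) =
      ∣m∣n⇒∣m+n (*-pres-∣ m∣u₁ n∣u₂) (∣n⇒∣m*n b (*-pres-∣ m∣v₁ n∣v₂))
    , ∣m∣n⇒∣m+n (∣m∣n⇒∣m+n (*-pres-∣ m∣u₁ n∣v₂) (*-pres-∣ m∣v₁ n∣u₂)) (∣n⇒∣m*n a (*-pres-∣ m∣v₁ n∣v₂))

  m*n∣ᵅ⇒m∣ᵅ : ∀ {m n x} → (m ℕ.* n) ∣ᵅ x → m ∣ᵅ x
  m*n∣ᵅ⇒m∣ᵅ (mn∣u , mn∣v) = m*n∣⇒m∣ mn∣u , m*n∣⇒m∣ mn∣v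

  m∣ᵅιm : ∀ m → m ∣ᵅ ι (+ m)
  m∣ᵅιm m = ∣-refl , divides 0ℤ refl

  ∣ᵅ-⊗ʳ : ∀ {m x} y → m ∣ᵅ x → m ∣ᵅ (x ⊗ y)
  ∣ᵅ-⊗ʳ {m} {x} y m∣x = subst (m ∣ᵅ_) (⊗-comm y x) (IsIdeal.*∈ (∣ᵅ-isIdeal m) y m∣x)

  ∣ᵅ-σ : ∀ {m x} → m ∣ᵅ x → m ∣ᵅ σ x
  ∣ᵅ-σ {x = u , v} (m∣u , m∣v) = ∣m∣n⇒∣m+n m∣u (∣n⇒∣m*n a m∣v) , ∣m⇒∣-m m∣v

  Cancellable : ℕ → ℤ → Set
  Cancellable m c = ∀ {x} → m ∣ᵅ ι c ⊗ x → m ∣ᵅ x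

  prime-cancellable : ∀ {p c} → Prime p → ¬ + p ∣ c → Cancellable p c
  prime-cancellable {p} {c} p-prime p∤c {u , v} p∣cx with subst (p ∣ᵅ_) (ι-⊗ c u v) p∣cx
  ... | p∣cu , p∣cv = prime-∣-cancelˡ p-prime p∤c p∣cu , prime-∣-cancelˡ p-prime p∤c p∣cv

  prime²-cancellable : ∀ {p c} → Prime p → ¬ + p ∣ c → Cancellable (p ℕ.* p) c
  prime²-cancellable {p} {c} p-prime p∤c {u , v} p²∣cx with subst ((p ℕ.* p) ∣ᵅ_) (ι-⊗ c u v) p²∣cx
  ... | p²∣cu , p²∣cv = prime²-∣-cancelˡ p-prime p∤c p²∣cu , prime²-∣-cancelˡ p-prime p∤c p²∣cv

  ℤ[α]/_ : ℕ → CommutativeRing 0ℓ 0ℓ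
  ℤ[α]/ m = Quotient.quotientRing commutativeRing (∣ᵅ-isIdeal m)

  infix 4 _≡_[mod_]ᵅ
  _≡_[mod_]ᵅ : Zα → Zα → ℕ → Set
  x ≡ y [mod m ]ᵅ = CommutativeRing._≈_ (ℤ[α]/ m) x y

  ≡-mod-m*n⇒≡-mod-m : ∀ {m n x y} → x ≡ y [mod m ℕ.* n ]ᵅ → x ≡ y [mod m ]ᵅ
  ≡-mod-m*n⇒≡-mod-m ⟪ mn∣x-y ⟫ = ⟪ m*n∣ᵅ⇒m∣ᵅ mn∣x-y ⟫

  module Modulo (m : ℕ) where
    open CommutativeRing (ℤ[α]/ m) public
      using (_≈_; setoid; +-cong; +-congˡ; +-congʳ; *-cong; *-congˡ; *-congʳ; commutativeSemiring)
      renaming (refl to ≈-refl; sym to ≈-sym; trans to ≈-trans; reflexive to ≈-reflexive)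
    open import Algebra.Properties.Semiring.Exp (CommutativeRing.semiring (ℤ[α]/ m)) public
      using () renaming (_^_ to _^′_)
    open import Algebra.Properties.Semiring.Mult (CommutativeRing.semiring (ℤ[α]/ m)) public
      using () renaming (_×_ to _·_)

    ^α≡^′ : ∀ x n → x ^α n ≡ x ^′ n
    ^α≡^′ x zero    = refl
    ^α≡^′ x (suc n) = cong (x ⊗_) (^α≡^′ x n)

    ·≡ι⊗ : ∀ n x → n · x ≡ ι (+ n) ⊗ x
    ·≡ι⊗ zero    (u , v) = ≡.sym (ι-⊗ 0ℤ u v)
    ·≡ι⊗ (suc n) x       = ≡.trans (cong (x ⊕_) (·≡ι⊗ n x)) (≡.sym (≡.trans (⊗-distribʳ x one (ι (+ n)))
                                                                            (cong (_⊕ (ι (+ n) ⊗ x)) (⊗-identityˡ x))))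

    ∣ᵅ⇒≈0 : ∀ {x} → m ∣ᵅ x → x ≈ 0α
    ∣ᵅ⇒≈0 {x} m∣x = ⟪ subst (m ∣ᵅ_) (≡.sym (⊕-identityʳ x)) m∣x ⟫

    ≈0⇒∣ᵅ : ∀ {x} → x ≈ 0α → m ∣ᵅ x
    ≈0⇒∣ᵅ {x} ⟪ m∣x ⟫ = subst (m ∣ᵅ_) (⊕-identityʳ x) m∣x

    ι-cong : ∀ {x y} → + m ∣ x - y → ι x ≈ ι y
    ι-cong m∣x-y = ⟪ m∣x-y , divides 0ℤ refl ⟫

    ι-cancel : ∀ {c x y} → Cancellable m c → ι c ⊗ x ≈ ι c ⊗ y → x ≈ y
    ι-cancel {c} {x} {y} cancel ⟪ m∣cx-cy ⟫ = ⟪ cancel (subst (m ∣ᵅ_) (≡.sym (x[y-z]≈xy-xz (ι c) x y)) m∣cx-cy) ⟫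
      where open import Algebra.Properties.Ring (CommutativeRing.ring commutativeRing) using (x[y-z]≈xy-xz)

    ^α-cong : ∀ {x y} n → x ≈ y → x ^α n ≈ y ^α n
    ^α-cong zero    _   = ≈-refl
    ^α-cong (suc n) x≈y = *-cong x≈y (^α-cong n x≈y)

    m·≈0 : ∀ x → m · x ≈ 0α
    m·≈0 x = ∣ᵅ⇒≈0 (subst (m ∣ᵅ_) (≡.sym (·≡ι⊗ m x)) (∣ᵅ-⊗ʳ x (m∣ᵅιm m)))

  ≡[mod]ᵅ? : ∀ m x y → Dec (x ≡ y [mod m ]ᵅ)
  ≡[mod]ᵅ? m x y = map′ ⟪_⟫ difference∈I ((+ m ∣? _) ×-dec (+ m ∣? _))

  σ-cong : ∀ {m x y} → x ≡ y [mod m ]ᵅ → σ x ≡ σ y [mod m ]ᵅ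
  σ-cong {m} {x} {y} ⟪ m∣x-y ⟫ = ⟪ subst (m ∣ᵅ_) (≡.trans (σ-⊕ x (⊝ y)) (cong (σ x ⊕_) (σ-⊝ y))) (∣ᵅ-σ m∣x-y) ⟫

  f-cong : ∀ {m x y} → x ≡ y [mod m ]ᵅ → f x ≡ f y [mod m ]ᵅ
  f-cong {m} {x} {y} x≈y = +-cong x²-ax≈y²-ay (≈-refl {⊝ ι b})
    where
    open Modulo m
    open CommutativeRing (ℤ[α]/ m) using (-‿cong)
    x²-ax≈y²-ay : (x ⊗ x) ⊕ (⊝ (ι a ⊗ x)) ≡ (y ⊗ y) ⊕ (⊝ (ι a ⊗ y)) [mod m ]ᵅ
    x²-ax≈y²-ay = +-cong (*-cong x≈y x≈y) (-‿cong (*-congˡ {ι a} x≈y))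

  α-cancel : ∀ {m x y} → Cancellable m (- b) → α ⊗ x ≡ α ⊗ y [mod m ]ᵅ → x ≡ y [mod m ]ᵅ
  α-cancel {m} {x} {y} cancel αx≈αy = ι-cancel { - b} {x} {y} cancel (begin
    ι (- b) ⊗ x     ≡⟨ cong (_⊗ x) (≡.sym β⊗α≡ι[-b]) ⟩
    (β ⊗ α) ⊗ x     ≡⟨ ⊗-assoc β α x ⟩
    β ⊗ (α ⊗ x)     ≈⟨ *-congˡ {β} αx≈αy ⟩
    β ⊗ (α ⊗ y)     ≡⟨ ≡.sym (⊗-assoc β α y) ⟩
    (β ⊗ α) ⊗ y     ≡⟨ cong (_⊗ y) β⊗α≡ι[-b] ⟩
    ι (- b) ⊗ y     ∎)
    where open Modulo m
          open import Relation.Binary.Reasoning.Setoid setoid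

  pow-lift : ∀ p {x y} → x ≡ y [mod p ]ᵅ → x ^α p ≡ y ^α p [mod p ℕ.* p ]ᵅ
  pow-lift zero    _                = Modulo.≈-refl 0
  pow-lift (suc k) {x} {y} ⟪ p∣d ⟫ = begin
    x ^α p                            ≡⟨ cong (_^α p) (≡.sym (y⊕[x⊖y]≡x x y)) ⟩
    (y ⊕ d) ^α p                      ≡⟨ ^α≡^′ (y ⊕ d) p ⟩
    (y ⊕ d) ^′ p                      ≈⟨ first-order-binomial {y} {d} d²≈0 k ⟩
    (y ^′ p) ⊕ (p · (d ⊗ (y ^′ k)))   ≈⟨ +-congˡ {y ^′ p} (∣ᵅ⇒≈0 p²∣p·[d⊗y^k]) ⟩
    (y ^′ p) ⊕ 0α                     ≡⟨ ⊕-identityʳ (y ^′ p) ⟩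
    y ^′ p                            ≡⟨ ≡.sym (^α≡^′ y p) ⟩
    y ^α p                            ∎
    where
    p = suc k
    d = x ⊖ y
    open Modulo (p ℕ.* p)
    open PowersOfSums commutativeSemiring using (first-order-binomial)
    open import Relation.Binary.Reasoning.Setoid setoid
    d²≈0 : d ⊗ d ≈ 0α
    d²≈0 = ∣ᵅ⇒≈0 (∣ᵅ-* p∣d p∣d)
    p²∣p·[d⊗y^k] : (p ℕ.* p) ∣ᵅ (p · (d ⊗ (y ^′ k)))
    p²∣p·[d⊗y^k] = subst ((p ℕ.* p) ∣ᵅ_) (≡.sym (·≡ι⊗ p (d ⊗ (y ^′ k)))) (∣ᵅ-* (m∣ᵅιm p) (∣ᵅ-⊗ʳ (y ^′ k) p∣d))

  one-plus-power : ∀ {p E} → p ∣ᵅ E → ∀ k → (one ⊕ E) ^α suc k ≡ one ⊕ (ι (+ suc k) ⊗ E) [mod p ℕ.* p ]ᵅ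
  one-plus-power {p} {E} p∣E k = begin
    (one ⊕ E) ^α suc k                          ≡⟨ ^α≡^′ (one ⊕ E) (suc k) ⟩
    (one ⊕ E) ^′ suc k                          ≈⟨ first-order-binomial {one} {E} (∣ᵅ⇒≈0 (∣ᵅ-* p∣E p∣E)) k ⟩
    (one ^′ suc k) ⊕ (suc k · (E ⊗ (one ^′ k))) ≡⟨ cong₂ _⊕_ (one^′≡one (suc k)) (·≡ι⊗ (suc k) (E ⊗ (one ^′ k))) ⟩
    one ⊕ (ι (+ suc k) ⊗ (E ⊗ (one ^′ k)))      ≡⟨ cong (λ z → one ⊕ (ι (+ suc k) ⊗ (E ⊗ z))) (one^′≡one k) ⟩
    one ⊕ (ι (+ suc k) ⊗ (E ⊗ one))             ≡⟨ cong (λ z → one ⊕ (ι (+ suc k) ⊗ z)) (⊗-identityʳ E) ⟩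
    one ⊕ (ι (+ suc k) ⊗ E)                     ∎
    where
    open Modulo (p ℕ.* p)
    open PowersOfSums commutativeSemiring using (first-order-binomial)
    open import Relation.Binary.Reasoning.Setoid setoid
    one^′≡one : ∀ n → one ^′ n ≡ one
    one^′≡one n = ≡.trans (≡.sym (^α≡^′ one n)) (one-^α n)

  frobenius : ∀ {p} → Prime p → ∀ x y → (x ⊕ y) ^α p ≡ (x ^α p) ⊕ (y ^α p) [mod p ]ᵅ
  frobenius {zero}  p-prime = contradiction p-prime ¬prime[0]
  frobenius {suc n} p-prime x y = begin
    (x ⊕ y) ^α p              ≡⟨ ^α≡^′ (x ⊕ y) p ⟩
    (x ⊕ y) ^′ p              ≈⟨ freshman's-dream x y ⟩
    (x ^′ p) ⊕ (y ^′ p)       ≡⟨ ≡.sym (≡.cong₂ _⊕_ (^α≡^′ x p) (^α≡^′ y p)) ⟩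
    (x ^α p) ⊕ (y ^α p)       ∎
    where
    p = suc n
    open Modulo p
    open PowersOfSums commutativeSemiring using (module Frobenius)
    open Frobenius p-prime m·≈0 using (freshman's-dream)
    open import Relation.Binary.Reasoning.Setoid setoid

  fermat-ι : ∀ {p} → Prime p → ∀ c → ι (+ c) ^α p ≡ ι (+ c) [mod p ]ᵅ
  fermat-ι {p} p-prime c = ≈-trans (≈-reflexive (≡.sym (ι-^ (+ c) p))) (ι-cong (fermat-ℤ p-prime c))
    where open Modulo p

  period⇒α^≡1 : ∀ {m n} → Cancellable m (- b) → IsPeriod a b m n → α ^α n ≡ one [mod m ]ᵅ
  period⇒α^≡1 {m} {suc n} cancel (_ , period) = α-cancel cancel (begin
    α ^α suc (suc n)                           ≡⟨ α^suc≡U (suc n) ⟩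
    (b * U a b (suc n) , U a b (suc (suc n)))  ≈⟨ ⟪ m∣bU , ∣ᵤ⇒∣ (period 1) ⟫ ⟩
    α                                          ≡⟨ ≡.sym (⊗-identityʳ α) ⟩
    α ⊗ one                                    ∎)
    where
    open Modulo m
    open import Relation.Binary.Reasoning.Setoid setoid
    m∣bU : + m ∣ b * U a b (suc n) - 0ℤ
    m∣bU = subst (+ m ∣_) (b*[x-0]≡b*x-0 b (U a b (suc n))) (∣n⇒∣m*n b (∣ᵤ⇒∣ (period 0)))
      where
      b*[x-0]≡b*x-0 : ∀ b x → b * (x - 0ℤ) ≡ b * x - 0ℤ
      b*[x-0]≡b*x-0 = solve-∀

  α^≡1⇒period : ∀ {m n} → 0 < n → α ^α n ≡ one [mod m ]ᵅ → IsPeriod a b m n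
  α^≡1⇒period {m} {suc n} 0<n α^n≈1 = 0<n , period
    where
    open Modulo m
    open import Relation.Binary.Reasoning.Setoid setoid
    period : ∀ k → U a b (k ℕ.+ suc n) ≡ U a b k [mod m ]
    period zero    = ∣⇒∣ᵤ (proj₂ (difference∈I (≈-trans (≈-reflexive (≡.sym (α^suc≡U n))) α^n≈1)))
    period (suc k) = ∣⇒∣ᵤ (proj₂ (difference∈I (begin
      (b * U a b (k ℕ.+ suc n) , U a b (suc (k ℕ.+ suc n)))  ≡⟨ ≡.sym (α^suc≡U (k ℕ.+ suc n)) ⟩
      α ^α (suc k ℕ.+ suc n)                                  ≡⟨ ^α-+ α (suc k) (suc n) ⟩
      (α ^α suc k) ⊗ (α ^α suc n)                             ≈⟨ *-congˡ {α ^α suc k} α^n≈1 ⟩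
      (α ^α suc k) ⊗ one                                      ≡⟨ ⊗-identityʳ (α ^α suc k) ⟩
      α ^α suc k                                              ≡⟨ α^suc≡U k ⟩
      (b * U a b k , U a b (suc k))                           ∎)))

  α^suc≡α⇔α^≡1 : ∀ {m k} → Cancellable m (- b) → α ^α suc k ≡ α [mod m ]ᵅ ⇔ α ^α k ≡ one [mod m ]ᵅ
  α^suc≡α⇔α^≡1 {m} {k} cancel = mk⇔
    (λ α^suc≈α → α-cancel cancel (≈-trans α^suc≈α (≈-reflexive (≡.sym (⊗-identityʳ α)))))
    (λ α^k≈1 → ≈-trans (*-congˡ {α} α^k≈1) (≈-reflexive (⊗-identityʳ α)))
    where open Modulo m

  period-length∣period : ∀ {m N k} → Cancellable m (- b) → IsPeriodLength a b m N → IsPeriod a b m k → N ℕ.∣ k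
  period-length∣period {m} {N} {k} cancel ((0<N , N-period) , least) k-period =
    ℕ.m%n≡0⇒n∣m k N (remainder≡0 (k % N) refl)
    where
    instance _ = ℕ.>-nonZero 0<N
    open Modulo m
    open import Relation.Binary.Reasoning.Setoid setoid
    α^N≈1 : α ^α N ≈ one
    α^N≈1 = period⇒α^≡1 cancel (0<N , N-period)
    remainder≡0 : ∀ r → r ≡ k % N → r ≡ 0
    remainder≡0 zero    _   = refl
    remainder≡0 (suc r) r≡k%N = contradiction (least (suc r) (α^≡1⇒period ℕ.z<s α^r≈1))
                                              (ℕ.<⇒≱ (≡.subst (_< N) (≡.sym r≡k%N) (m%n<n k N)))
      where
      α^r≈1 : α ^α suc r ≈ one
      α^r≈1 = begin
        α ^α suc r                            ≡⟨ ≡.sym (⊗-identityʳ (α ^α suc r)) ⟩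
        (α ^α suc r) ⊗ one                    ≡⟨ cong ((α ^α suc r) ⊗_) (≡.sym (one-^α (k / N))) ⟩
        (α ^α suc r) ⊗ (one ^α (k / N))       ≈⟨ *-congˡ {α ^α suc r} (^α-cong (k / N) (≈-sym α^N≈1)) ⟩
        (α ^α suc r) ⊗ ((α ^α N) ^α (k / N))  ≡⟨ cong ((α ^α suc r) ⊗_) (≡.sym (^α-* α (k / N) N)) ⟩
        (α ^α suc r) ⊗ (α ^α (k / N ℕ.* N))   ≡⟨ ≡.sym (^α-+ α (suc r) (k / N ℕ.* N)) ⟩
        α ^α (suc r ℕ.+ k / N ℕ.* N)          ≡⟨ cong (λ e → α ^α (e ℕ.+ k / N ℕ.* N)) r≡k%N ⟩
        α ^α (k % N ℕ.+ k / N ℕ.* N)          ≡⟨ cong (α ^α_) (≡.sym (m≡m%n+[m/n]*n k N)) ⟩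
        α ^α k                                ≈⟨ period⇒α^≡1 cancel k-period ⟩
        one                                   ∎

  α^p≡β⇒α^p²≡α : ∀ {p} → α ^α p ≡ β [mod p ]ᵅ → α ^α (p ℕ.* p) ≡ α [mod p ]ᵅ
  α^p≡β⇒α^p²≡α {p} α^p≡β = begin
    α ^α (p ℕ.* p)   ≡⟨ ^α-* α p p ⟩
    (α ^α p) ^α p    ≈⟨ ^α-cong p α^p≡β ⟩
    β ^α p           ≡⟨ β^n≡σ[α^n] p ⟩
    σ (α ^α p)       ≈⟨ σ-cong α^p≡β ⟩
    σ β              ≡⟨ cong σ (≡.sym σ-α) ⟩
    σ (σ α)          ≡⟨ σ-involutive α ⟩
    α                ∎
    where open Modulo p
          open import Relation.Binary.Reasoning.Setoid setoid

  module Lifting (p : ℕ) (α^p≡β : α ^α p ≡ β [mod p ]ᵅ) where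
    open Modulo (p ℕ.* p)
    open import Relation.Binary.Reasoning.Setoid setoid

    private
      p² = p ℕ.* p

    γ : Zα
    γ = α ^α p

    γ^p≡σγ : γ ^α p ≡ σ γ [mod p² ]ᵅ
    γ^p≡σγ = ≈-trans (pow-lift p α^p≡β) (≈-reflexive (β^n≡σ[α^n] p))

    ≡γ⇒^p≡σγ : ∀ {x} → x ≡ γ [mod p² ]ᵅ → x ^α p ≡ σ γ [mod p² ]ᵅ
    ≡γ⇒^p≡σγ x≈γ = ≈-trans (^α-cong p x≈γ) γ^p≡σγ

    ≡σγ⇒^p≡γ : ∀ {x} → x ≡ σ γ [mod p² ]ᵅ → x ^α p ≡ γ [mod p² ]ᵅ
    ≡σγ⇒^p≡γ {x} x≈σγ = begin
      x ^α p        ≈⟨ ^α-cong p x≈σγ ⟩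
      σ γ ^α p      ≡⟨ ≡.sym (σ-^α γ p) ⟩
      σ (γ ^α p)    ≈⟨ σ-cong γ^p≡σγ ⟩
      σ (σ γ)       ≡⟨ σ-involutive γ ⟩
      γ             ∎

    α^p^k≡γ∨σγ : ∀ k → α ^α (p ℕ.^ suc k) ≡ γ [mod p² ]ᵅ ⊎ α ^α (p ℕ.^ suc k) ≡ σ γ [mod p² ]ᵅ
    α^p^k≡γ∨σγ zero    = inj₁ (≈-reflexive (cong (α ^α_) (ℕ.*-identityʳ p)))
    α^p^k≡γ∨σγ (suc k) =
      subst (λ x → x ≡ γ [mod p² ]ᵅ ⊎ x ≡ σ γ [mod p² ]ᵅ) (≡.sym (^α-* α p (p ℕ.^ suc k)))
            ([ inj₂ ∘ ≡γ⇒^p≡σγ , inj₁ ∘ ≡σγ⇒^p≡γ ]′ (α^p^k≡γ∨σγ k))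

    Root : Zα → Set
    Root x = f x ≡ 0α [mod p² ]ᵅ

    root-σ : ∀ x → Root x → Root (σ x)
    root-σ x fx≈0 = begin
      f (σ x)   ≡⟨ f-σ x ⟩
      σ (f x)   ≈⟨ σ-cong fx≈0 ⟩
      σ 0α      ≡⟨ σ-ι 0ℤ ⟩
      0α        ∎

    root-σ⇔ : ∀ x → Root (σ x) ⇔ Root x
    root-σ⇔ x = mk⇔ (λ fσx≈0 → subst Root (σ-involutive x) (root-σ (σ x) fσx≈0)) (root-σ x)

    root-⇔ : ∀ {x y} → x ≡ y [mod p² ]ᵅ → Root x ⇔ Root y
    root-⇔ x≈y = mk⇔ (≈-trans (≈-sym (f-cong x≈y))) (≈-trans (f-cong x≈y))

    root-α^p^k⇔root-γ : ∀ k → Root (α ^α (p ℕ.^ suc k)) ⇔ Root γ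
    root-α^p^k⇔root-γ k = [ root-⇔ , (λ ≈σγ → ⇔-trans (root-⇔ ≈σγ) (root-σ⇔ γ)) ]′ (α^p^k≡γ∨σγ k)

    root-γ⇔γ≡β : Cancellable p² (a * a + + 4 * b) → Root γ ⇔ γ ≡ β [mod p² ]ᵅ
    root-γ⇔γ≡β cancel = mk⇔ ⇒ ⇐
      where
      t = γ ⊖ β
      t²≈0 : t ⊗ t ≈ 0α
      t²≈0 = ∣ᵅ⇒≈0 (∣ᵅ-* (difference∈I α^p≡β) (difference∈I α^p≡β))
      ⇒ : Root γ → γ ≡ β [mod p² ]ᵅ
      ⇒ fγ≈0 = ⟪ cancel (≈0⇒∣ᵅ (begin
        ι (a * a + + 4 * b) ⊗ t   ≡⟨ cong (_⊗ t) (≡.sym δ-square) ⟩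
        (δ ⊗ δ) ⊗ t               ≡⟨ ⊗-assoc δ δ t ⟩
        δ ⊗ (δ ⊗ t)               ≈⟨ *-congˡ {δ} δt≈0 ⟩
        δ ⊗ 0α                    ≡⟨ ⊗-zeroʳ δ ⟩
        0α                        ∎)) ⟫
        where
        δt≈0 : δ ⊗ t ≈ 0α
        δt≈0 = begin
          δ ⊗ t                   ≡⟨ ≡.sym (⊕-identityˡ (δ ⊗ t)) ⟩
          0α ⊕ (δ ⊗ t)            ≈⟨ +-congʳ {δ ⊗ t} (≈-sym t²≈0) ⟩
          (t ⊗ t) ⊕ (δ ⊗ t)       ≡⟨ ≡.sym (f-expand γ) ⟩
          f γ                     ≈⟨ fγ≈0 ⟩
          0α                      ∎
      ⇐ : γ ≡ β [mod p² ]ᵅ → Root γ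
      ⇐ ⟪ p²∣t ⟫ = ∣ᵅ⇒≈0 (≡.subst (p² ∣ᵅ_) (≡.sym (f-expand γ))
                     (IsIdeal.+∈ (∣ᵅ-isIdeal p²) (∣ᵅ-⊗ʳ t p²∣t) (IsIdeal.*∈ (∣ᵅ-isIdeal p²) δ p²∣t)))

    γ≡β⇔α^p²≡α : γ ≡ β [mod p² ]ᵅ ⇔ α ^α p² ≡ α [mod p² ]ᵅ
    γ≡β⇔α^p²≡α = mk⇔ ⇒ ⇐
      where
      α^p²≈σγ : α ^α p² ≈ σ γ
      α^p²≈σγ = ≈-trans (≈-reflexive (^α-* α p p)) γ^p≡σγ
      ⇒ : γ ≡ β [mod p² ]ᵅ → α ^α p² ≡ α [mod p² ]ᵅ
      ⇒ γ≈β = begin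
        α ^α p²   ≈⟨ α^p²≈σγ ⟩
        σ γ       ≈⟨ σ-cong γ≈β ⟩
        σ β       ≡⟨ cong σ (≡.sym σ-α) ⟩
        σ (σ α)   ≡⟨ σ-involutive α ⟩
        α         ∎
      ⇐ : α ^α p² ≡ α [mod p² ]ᵅ → γ ≡ β [mod p² ]ᵅ
      ⇐ α^p²≈α = begin
        γ         ≡⟨ ≡.sym (σ-involutive γ) ⟩
        σ (σ γ)   ≈⟨ σ-cong (≈-trans (≈-sym α^p²≈σγ) α^p²≈α) ⟩
        σ α       ≡⟨ σ-α ⟩
        β         ∎

module _ (a b : ℕ) where
  open ℤ[α] (+ a) (+ b)

  private
    Δ = + a * + a + + 4 * + b

  inert⇒α^p≡β : ∀ {p h} → Prime p → p ≡ suc (h ℕ.+ h) → ¬ + p ∣ + 2 → + p ∣ Δ ^ h + 1ℤ →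
                α ^α p ≡ β [mod p ]ᵅ
  inert⇒α^p≡β {p} {h} p-prime refl p∤2 p∣Δ^h+1 =
    ι-cancel {+ 2} {α ^α p} {β} (prime-cancellable p-prime p∤2) (begin
      ι (+ 2) ⊗ (α ^α p)                   ≈⟨ *-congʳ {α ^α p} (≈-sym (fermat-ι p-prime 2)) ⟩
      (ι (+ 2) ^α p) ⊗ (α ^α p)            ≡⟨ ≡.sym (⊗-^α (ι (+ 2)) α p) ⟩
      (ι (+ 2) ⊗ α) ^α p                   ≡⟨ ≡.sym ([⊝x⊕y]⊕x≡y δ ((ι (+ 2) ⊗ α) ^α p)) ⟩
      ((⊝ δ) ⊕ ((ι (+ 2) ⊗ α) ^α p)) ⊕ δ   ≈⟨ +-congʳ {δ} (≈-sym ι-a≈-δ+[2α]^p) ⟩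
      ι (+ a) ⊕ δ                          ≡⟨ ι-a+δ≡2β ⟩
      ι (+ 2) ⊗ β                          ∎)
    where
    open Modulo p
    open import Relation.Binary.Reasoning.Setoid setoid
    δ^p≈-δ : δ ^α p ≈ ⊝ δ
    δ^p≈-δ = begin
      δ ⊗ (δ ^α (h ℕ.+ h))       ≡⟨ cong (δ ⊗_) (≡.trans (^α-+ δ h h) (≡.sym (⊗-^α δ δ h))) ⟩
      δ ⊗ ((δ ⊗ δ) ^α h)         ≡⟨ cong (λ z → δ ⊗ (z ^α h)) δ-square ⟩
      δ ⊗ (ι Δ ^α h)             ≡⟨ cong (δ ⊗_) (≡.sym (ι-^ Δ h)) ⟩
      δ ⊗ ι (Δ ^ h)              ≈⟨ *-congˡ {δ} (ι-cong p∣Δ^h+1) ⟩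
      δ ⊗ ι -1ℤ                  ≡⟨ ⊗-ι-1 δ ⟩
      ⊝ δ                        ∎
    ι-a≈-δ+[2α]^p : ι (+ a) ≈ (⊝ δ) ⊕ ((ι (+ 2) ⊗ α) ^α p)
    ι-a≈-δ+[2α]^p = begin
      ι (+ a)                           ≈⟨ ≈-sym (fermat-ι p-prime a) ⟩
      ι (+ a) ^α p                      ≡⟨ cong (_^α p) ι-a≡δ+2α ⟩
      (δ ⊕ (ι (+ 2) ⊗ α)) ^α p          ≈⟨ frobenius p-prime δ (ι (+ 2) ⊗ α) ⟩
      (δ ^α p) ⊕ ((ι (+ 2) ⊗ α) ^α p)   ≈⟨ +-congʳ {(ι (+ 2) ⊗ α) ^α p} δ^p≈-δ ⟩
      (⊝ δ) ⊕ ((ι (+ 2) ⊗ α) ^α p)      ∎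

-- Periods and Wall–Sun–Sun primes

least-witness : ∀ {ℓ} {P : Pred ℕ ℓ} → Decidable P → ∀ {n} → P n → ∃[ m ] (P m × ∀ {k} → P k → m ≤ k)
least-witness {P = P} P? {n} Pn = search 0 n (ℕ.+-identityʳ n) (λ ())
  where
  search : ∀ k d → d ℕ.+ k ≡ n → (∀ {j} → j < k → ¬ P j) → ∃[ m ] (P m × ∀ {j} → P j → m ≤ j)
  search k d d+k≡n below with P? k
  ... | yes Pk = k , Pk , λ Pj → ℕ.≮⇒≥ (λ j<k → below j<k Pj)
  search k zero    k≡n   below | no ¬Pk = contradiction (subst P (≡.sym k≡n) Pn) ¬Pk
  search k (suc d) d+k≡n below | no ¬Pk = search (suc k) d (≡.trans (ℕ.+-suc d k) d+k≡n) below′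
    where
    below′ : ∀ {j} → j < suc k → ¬ P j
    below′ j<1+k with ℕ.m≤n⇒m<n∨m≡n (ℕ.s≤s⁻¹ j<1+k)
    ... | inj₁ j<k  = below j<k
    ... | inj₂ refl = ¬Pk

module WallSunSunCriterion (a b : ℕ) {n} (p-prime : Prime (suc n)) (p∤b : ¬ + suc n ∣ + b) where
  open ℤ[α] (+ a) (+ b)

  private
    p = suc n
    p² = p ℕ.* p

  p²-1 : ℕ
  p²-1 = n ℕ.+ n ℕ.* p

  0<p²-1 : 0 < p²-1
  0<p²-1 = ℕ.<-≤-trans (ℕ.s≤s⁻¹ (ℕ.nonTrivial⇒n>1 p {{prime⇒nonTrivial p-prime}})) (ℕ.m≤m+n n (n ℕ.* p))

  p∤-b : ¬ + p ∣ - + b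
  p∤-b p∣-b = p∤b (subst (+ p ∣_) (ℤ.neg-involutive (+ b)) (∣m⇒∣-m p∣-b))

  cancel-p : Cancellable p (- + b)
  cancel-p = prime-cancellable p-prime p∤-b

  cancel-p² : Cancellable p² (- + b)
  cancel-p² = prime²-cancellable p-prime p∤-b

  coprime : Coprime b p
  coprime (d∣b , d∣p) with prime⇒irreducible p-prime d∣p
  ... | inj₁ d≡1  = d≡1
  ... | inj₂ refl = contradiction (∣ᵤ⇒∣ d∣b) p∤b

  UnitPower : ℕ → Set
  UnitPower k = 0 < k × α ^α k ≡ one [mod p ]ᵅ

  unitPower? : ∀ k → Dec (UnitPower k)
  unitPower? k = (0 ℕ.<? k) ×-dec ≡[mod]ᵅ? p (α ^α k) one

  module _ (α^p²-1≡1 : α ^α p²-1 ≡ one [mod p ]ᵅ) where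
    open Modulo p²
    open import Relation.Binary.Reasoning.Setoid setoid

    p²-1-period : IsPeriod (+ a) (+ b) p p²-1
    p²-1-period = α^≡1⇒period 0<p²-1 α^p²-1≡1

    wall-sun-sun⇒α^p²-1≡1 : WallSunSun a b p → α ^α p²-1 ≡ one [mod p² ]ᵅ
    wall-sun-sun⇒α^p²-1≡1 (_ , N , (N-period-p² , _) , N-period-length-p) =
      power-of-unit (period-length∣period cancel-p N-period-length-p p²-1-period)
      where
      power-of-unit : N ℕ.∣ p²-1 → α ^α p²-1 ≡ one [mod p² ]ᵅ
      power-of-unit (ℕ.divides q p²-1≡q*N) = begin
        α ^α p²-1          ≡⟨ cong (α ^α_) p²-1≡q*N ⟩
        α ^α (q ℕ.* N)     ≡⟨ ^α-* α q N ⟩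
        (α ^α N) ^α q      ≈⟨ ^α-cong q (period⇒α^≡1 cancel-p² N-period-p²) ⟩
        one ^α q           ≡⟨ one-^α q ⟩
        one                ∎

    module _ (α^p²-1≡1-p² : α ^α p²-1 ≡ one [mod p² ]ᵅ) where

      α^N≡1-lifts : ∀ {N} → α ^α N ≡ one [mod p ]ᵅ → N ℕ.∣ p²-1 → α ^α N ≡ one [mod p² ]ᵅ
      α^N≡1-lifts α^N≡1 (ℕ.divides zero    p²-1≡0)   = contradiction p²-1≡0 (ℕ.>⇒≢ 0<p²-1)
      α^N≡1-lifts {N} α^N≡1 (ℕ.divides (suc q) p²-1≡q*N) = ⟪ prime²-cancellable p-prime p∤q (≈0⇒∣ᵅ qE≈0) ⟫
        where
        open import Algebra.Properties.Group (CommutativeRing.+-group (ℤ[α]/ p²)) using (identityʳ-unique)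
        E = (α ^α N) ⊖ one
        qE≈0 : ι (+ suc q) ⊗ E ≈ 0α
        qE≈0 = identityʳ-unique one (ι (+ suc q) ⊗ E) (begin
          one ⊕ (ι (+ suc q) ⊗ E)   ≈⟨ ≈-sym (one-plus-power (difference∈I α^N≡1) q) ⟩
          (one ⊕ E) ^α suc q        ≡⟨ cong (_^α suc q) (y⊕[x⊖y]≡x (α ^α N) one) ⟩
          (α ^α N) ^α suc q         ≡⟨ ≡.sym (^α-* α (suc q) N) ⟩
          α ^α (suc q ℕ.* N)        ≡⟨ cong (α ^α_) (≡.sym p²-1≡q*N) ⟩
          α ^α p²-1                 ≈⟨ α^p²-1≡1-p² ⟩
          one                       ∎)
        p∤q : ¬ + p ∣ + suc q
        p∤q p∣q = prime∤1 p-prime (ℕ.∣m+n∣m⇒∣n (subst (p ℕ.∣_) (ℕ.+-comm 1 p²-1) (ℕ.∣m⇒∣m*n p ℕ.∣-refl))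
                                                (subst (p ℕ.∣_) (≡.sym p²-1≡q*N) (ℕ.∣m⇒∣m*n N (∣⇒∣ᵤ p∣q))))

      α^p²-1≡1⇒wall-sun-sun : WallSunSun a b p
      α^p²-1≡1⇒wall-sun-sun = from-least (least-witness unitPower? (0<p²-1 , α^p²-1≡1))
        where
        from-least : ∃[ N ] (UnitPower N × ∀ {k} → UnitPower k → N ≤ k) → WallSunSun a b p
        from-least (N , (0<N , α^N≡1) , least) =
          coprime , N , (α^≡1⇒period 0<N α^N≡1-p² , least-p²) , N-period-length-p
          where
          least-p : ∀ k → IsPeriod (+ a) (+ b) p k → N ≤ k
          least-p k k-period = least (proj₁ k-period , period⇒α^≡1 cancel-p k-period)
          least-p² : ∀ k → IsPeriod (+ a) (+ b) p² k → N ≤ k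
          least-p² k k-period = least (proj₁ k-period , ≡-mod-m*n⇒≡-mod-m (period⇒α^≡1 cancel-p² k-period))
          N-period-length-p : IsPeriodLength (+ a) (+ b) p N
          N-period-length-p = α^≡1⇒period 0<N α^N≡1 , least-p
          α^N≡1-p² : α ^α N ≡ one [mod p² ]ᵅ
          α^N≡1-p² = α^N≡1-lifts α^N≡1 (period-length∣period cancel-p N-period-length-p p²-1-period)

    wall-sun-sun⇔α^p²-1≡1 : WallSunSun a b p ⇔ α ^α p²-1 ≡ one [mod p² ]ᵅ
    wall-sun-sun⇔α^p²-1≡1 = mk⇔ wall-sun-sun⇒α^p²-1≡1 α^p²-1≡1⇒wall-sun-sun

odd-prime : ∀ {p} → Prime p → 3 ≤ p → ∃[ h ] p ≡ suc (h ℕ.+ h)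
odd-prime {p} p-prime 3≤p with p % 2 | m≡m%n+[m/n]*n p 2 | m%n<n p 2
... | 1           | p≡1+q*2 | _ = p / 2 , ≡.trans p≡1+q*2 (1+q*2≡1+[q+q] (p / 2))
  where
  1+q*2≡1+[q+q] : ∀ q → 1 ℕ.+ q ℕ.* 2 ≡ suc (q ℕ.+ q)
  1+q*2≡1+[q+q] = ℕ-Solver.solve-∀
... | 0           | p≡q*2   | _ = contradiction (prime⇒irreducible p-prime (ℕ.divides (p / 2) p≡q*2))
                                  λ { (inj₁ ()) ; (inj₂ 2≡p) → ℕ.<⇒≱ 3≤p (ℕ.≤-reflexive (≡.sym 2≡p)) }
... | suc (suc _) | _       | s≤s (s≤s ())

discriminant : ℕ → ℕ → ℕ
discriminant a b = a ℕ.* a ℕ.+ 4 ℕ.* b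

𝒟≡discriminant⊎discriminant≡4𝒟 : ∀ a b → 𝒟 a b ≡ discriminant a b ⊎ discriminant a b ≡ 4 ℕ.* 𝒟 a b
𝒟≡discriminant⊎discriminant≡4𝒟 a b with a % 2 | m≡m%n+[m/n]*n a 2 | m%n<n a 2
... | 0           | a≡q*2 | _ = inj₂ (≡.trans (cong (λ a → a ℕ.* a ℕ.+ 4 ℕ.* b) a≡q*2) (square (a / 2) b))
  where
  square : ∀ q b → q ℕ.* 2 ℕ.* (q ℕ.* 2) ℕ.+ 4 ℕ.* b ≡ 4 ℕ.* (q ℕ.* q ℕ.+ b)
  square = ℕ-Solver.solve-∀
... | 1           | _     | _ = inj₁ refl
... | suc (suc _) | _     | s≤s (s≤s ())

QuadraticNonResidue : ℕ → ℤ → Set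
QuadraticNonResidue p D = ¬ + p ∣ D × (∀ x → ¬ + p ∣ x * x - D)

legendre⇒nonresidue : ∀ {D p} → LegendreMinusOne D p → QuadraticNonResidue p (+ D)
legendre⇒nonresidue (p∤D , nonresidue) = (λ p∣D → p∤D (∣⇒∣ᵤ p∣D)) , (λ x p∣x²-D → nonresidue x (∣⇒∣ᵤ p∣x²-D))

-- 1 + h is the inverse of 2 modulo p = 2h + 1.
nonresidue-4* : ∀ {p h} → Prime p → p ≡ suc (h ℕ.+ h) → ¬ + p ∣ + 2 → ∀ {D} →
                QuadraticNonResidue p D → QuadraticNonResidue p (+ 4 * D)
nonresidue-4* {p} {h} p-prime refl p∤2 {D} (p∤D , nonresidue) =
    (λ p∣4D → p∤D (cancel-4 (subst (+ p ∣_) (four D) p∣4D)))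
  , (λ x p∣x²-4D → nonresidue (x * (1ℤ + + h)) (cancel-4 (subst (+ p ∣_) (≡.sym (key x (+ h) D))
      (∣m∣n⇒∣m+n (∣m⇒∣m*n ((+ 2 * (1ℤ + + h) + 1ℤ) * (x * x)) ∣-refl)
                  (subst (λ E → + p ∣ x * x - E) (four D) p∣x²-4D)))))
  where
  cancel-4 : ∀ {z} → + p ∣ + 2 * (+ 2 * z) → + p ∣ z
  cancel-4 p∣4z = prime-∣-cancelˡ p-prime p∤2 (prime-∣-cancelˡ p-prime p∤2 p∣4z)
  four : ∀ D → + 4 * D ≡ + 2 * (+ 2 * D)
  four = solve-∀
  key : ∀ x h D → + 2 * (+ 2 * ((x * (1ℤ + h)) * (x * (1ℤ + h)) - D))
                ≡ (1ℤ + (h + h)) * ((+ 2 * (1ℤ + h) + 1ℤ) * (x * x)) + (x * x - + 2 * (+ 2 * D))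
  key = solve-∀

discriminant-nonresidue : ∀ a b {p h} → Prime p → p ≡ suc (h ℕ.+ h) → ¬ + p ∣ + 2 →
                          LegendreMinusOne (𝒟 a b) p → QuadraticNonResidue p (+ discriminant a b)
discriminant-nonresidue a b {p} {h} p-prime p≡2h+1 p∤2 legendre with 𝒟≡discriminant⊎discriminant≡4𝒟 a b
... | inj₁ 𝒟≡Δ  = subst (λ D → QuadraticNonResidue p (+ D)) 𝒟≡Δ (legendre⇒nonresidue legendre)
... | inj₂ Δ≡4𝒟 = subst (QuadraticNonResidue p) (≡.trans (≡.sym (ℤ.pos-* 4 (𝒟 a b))) (cong +_ (≡.sym Δ≡4𝒟)))
                        (nonresidue-4* {h = h} p-prime p≡2h+1 p∤2 (legendre⇒nonresidue legendre))

module InertPrime (a b n : ℕ) (p-prime : Prime (suc n)) (3≤p : 3 ≤ suc n)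
                  (legendre : LegendreMinusOne (𝒟 a b) (suc n)) where
  open ℤ[α] (+ a) (+ b)

  private
    p = suc n
    h = proj₁ (odd-prime p-prime 3≤p)
    p≡2h+1 = proj₂ (odd-prime p-prime 3≤p)
    Δ = discriminant a b

  p∤2 : ¬ + p ∣ + 2
  p∤2 = >⇒∤ℤ (s≤s z≤n) 3≤p

  Δ≡a²+4b : + Δ ≡ + a * + a + + 4 * + b
  Δ≡a²+4b = ≡.trans (ℤ.pos-+ (a ℕ.* a) (4 ℕ.* b)) (cong₂ _+_ (ℤ.pos-* a a) (ℤ.pos-* 4 b))

  Δ-nonresidue : QuadraticNonResidue p (+ Δ)
  Δ-nonresidue = discriminant-nonresidue a b {h = h} p-prime p≡2h+1 p∤2 legendre

  p∤b : ¬ + p ∣ + b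
  p∤b p∣b = proj₂ Δ-nonresidue (+ a) (subst (+ p ∣_) -4b≡a²-Δ (∣m⇒∣-m (∣n⇒∣m*n (+ 4) p∣b)))
    where
    -4b≡a²-Δ : - (+ 4 * + b) ≡ + a * + a - + Δ
    -4b≡a²-Δ = ≡.trans (rearrange (+ a) (+ b)) (cong (λ D → + a * + a - D) (≡.sym Δ≡a²+4b))
      where
      rearrange : ∀ a b → - (+ 4 * b) ≡ a * a - (a * a + + 4 * b)
      rearrange = solve-∀

  α^p≡β : α ^α p ≡ β [mod p ]ᵅ
  α^p≡β = inert⇒α^p≡β a b {h = h} p-prime p≡2h+1 p∤2 (subst (λ D → + p ∣ D ^ h + 1ℤ) Δ≡a²+4b
            (euler-nonresidue {h = h} p-prime p≡2h+1 Δ (proj₁ Δ-nonresidue) (proj₂ Δ-nonresidue)))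

  open Lifting p α^p≡β public
  open WallSunSunCriterion a b p-prime p∤b

  wall-sun-sun⇔root-γ : WallSunSun a b p ⇔ Root γ
  wall-sun-sun⇔root-γ =
    ⇔-trans (wall-sun-sun⇔α^p²-1≡1 (Equivalence.to (α^suc≡α⇔α^≡1 cancel-p) (α^p≡β⇒α^p²≡α α^p≡β)))
    (⇔-trans (⇔-sym (α^suc≡α⇔α^≡1 cancel-p²))
    (⇔-trans (⇔-sym γ≡β⇔α^p²≡α)
             (⇔-sym (root-γ⇔γ≡β cancel-Δ))))
    where
    cancel-Δ : Cancellable (p ℕ.* p) (+ a * + a + + 4 * + b)
    cancel-Δ = prime²-cancellable p-prime (subst (λ D → ¬ + p ∣ D) Δ≡a²+4b (proj₁ Δ-nonresidue))

  FαCong⇔root-γ : ∀ m → 1 ≤ m → FαCong a b p m ⇔ Root γ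
  FαCong⇔root-γ (suc k) _ = ⇔-trans (mk⇔ (λ (p²∣u , p²∣v) → ⟪ ∣ᵤ⇒∣ p²∣u , ∣ᵤ⇒∣ p²∣v ⟫)
                                          (λ { ⟪ p²∣u , p²∣v ⟫ → ∣⇒∣ᵤ p²∣u , ∣⇒∣ᵤ p²∣v }))
                                     (root-α^p^k⇔root-γ k)

lemma3p5 : (a b : ℕ) → 0 < a → 0 < b → ¬ (4 ℕ.∣ a) → Squarefree b → Squarefree (𝒟 a b)
    → (p : ℕ) → Prime p → 3 ≤ p → LegendreMinusOne (𝒟 a b) p
    → (WallSunSun a b p ⇔ (∀ m → 1 ≤ m → FαCong a b p m))
    × ((∀ m → 1 ≤ m → FαCong a b p m) ⇔ (∃[ m ] (1 ≤ m × FαCong a b p m)))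
lemma3p5 a b _ _ _ _ _ zero    p-prime = contradiction p-prime ¬prime[0]
lemma3p5 a b _ _ _ _ _ (suc n) p-prime 3≤p legendre =
    mk⇔ (λ wss m 1≤m → from (FαCong⇔root-γ m 1≤m) (to wall-sun-sun⇔root-γ wss))
        (λ all → from wall-sun-sun⇔root-γ (to (FαCong⇔root-γ 1 ℕ.≤-refl) (all 1 ℕ.≤-refl)))
  , mk⇔ (λ all → 1 , ℕ.≤-refl , all 1 ℕ.≤-refl)
        (λ { (m , 1≤m , Fm) m′ 1≤m′ → from (FαCong⇔root-γ m′ 1≤m′) (to (FαCong⇔root-γ m 1≤m) Fm) })
  where
  open InertPrime a b n p-prime 3≤p legendre
  open Equivalence
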